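{- Let $C\subseteq\mathbb{Z}_2^n$ be a $12$-cap of dimension $7$. Then $C$ has a basis of type $5\text{ - }5\text{ - }5\text{ - }5$. Moreover, for any such basis $B$, writing $D=C\setminus B=\{x_1,x_2,x_3,x_4\}$ and $B_{ij}=B_{x_i}\cap B_{x_j}$: (1) exactly one or exactly two of the six numbers $|B_{ij}|$ ($\{i,j\}\subseteq\{1,2,3,4\}$) equal $2$, and the rest equal $3$; (2) if $|B_{ij}|=|B_{k\ell}|=2$, then the pairs $\{i,j\}$ and $\{k,\ell\}$ are either equal or disjoint.
   Context: Work in $\mathbb{Z}_2^n$. An affine combination of a set is a sum of an odd number of its distinct elements; $\operatorname{aff}(S)$ is the set of all affine combinations of elements of $S$, and the dimension of $S$ is the dimension of the affine flat $\operatorname{aff}(S)$. A basis for $S$ is a subset $B\subseteq S$ that is affinely independent (no element is an affine combination of the others) with $\operatorname{aff}(B)=\operatorname{aff}(S)$; its dependent set is $D=S\setminus B$. For $x\in D$, $B_x$ is the unique subset of $B$ whose elements sum to $x$. A quad is a set of four distinct elements summing to $\mathbf{0}$; a cap is a quad-free subset; a $k$-cap is a cap with $k$ elements. The type of $B$ is the list of the numbers $|B_x|$, $x\in D$, in nonincreasing order, separated by hyphens. -}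

module Defs where

open import Data.Bool using (Bool; true; false; if_then_else_; _xor_)
open import Data.Nat using (ℕ; zero; suc; _%_)
open import Data.Fin using (Fin; zero; suc)
open import Data.Fin.Subset using (Subset; _∈_; _∉_; _⊆_; _∩_; _─_; _-_; ⊤; ∣_∣)
open import Data.Vec using (Vec; []; _∷_; zipWith; replicate)
open import Data.Product using (Σ; ∃; _×_; _,_)
open import Data.List using (List; []; _∷_; length; filter)
open import Function using (_∘_; _⇔_)
open import Function.Definitions using (Injective)
open import Relation.Nullary using (¬_)
open import Relation.Binary.PropositionalEquality using (_≡_; _≢_)
import Data.Nat as ℕ

V : ℕ → Set
V n = Vec Bool n

𝟎 : ∀ {n} → V n
𝟎 = replicate _ false

infixl 6 _⊕_
_⊕_ : ∀ {n} → V n → V n → V n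
_⊕_ = zipWith _xor_

-- Finite sets of points are given as families f : Fin m → V n;
-- subsets of the family are index subsets T : Subset m.
-- Sum of the points f i with i ∈ T.
sumOver : ∀ {m n} → (Fin m → V n) → Subset m → V n
sumOver {zero}  f []      = 𝟎
sumOver {suc m} f (b ∷ T) = (if b then f zero else 𝟎) ⊕ sumOver (f ∘ suc) T

Odd : ℕ → Set
Odd k = k % 2 ≡ 1

-- v is an affine combination of the elements indexed by S
-- (sum of an odd number of distinct elements of S).
InAff : ∀ {m n} → (Fin m → V n) → Subset m → V n → Set
InAff f S v = ∃ λ T → T ⊆ S × Odd ∣ T ∣ × sumOver f T ≡ v

AffIndep : ∀ {m n} → (Fin m → V n) → Subset m → Set
AffIndep f S = ∀ i → i ∈ S → ¬ InAff f (S - i) (f i)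

SameAff : ∀ {m m' n} → (Fin m → V n) → Subset m → (Fin m' → V n) → Subset m' → Set
SameAff {n = n} f S g S' = ∀ (v : V n) → InAff f S v ⇔ InAff g S' v

-- dimension of S is d: the affine flat aff(S) has an affine basis of d+1 points
-- (an affinely independent set of d+1 points of Z_2^n whose affine span is aff(S))
HasDim : ∀ {m n} → (Fin m → V n) → Subset m → ℕ → Set
HasDim {n = n} f S d =
  ∃ λ (g : Fin (suc d) → V n) → AffIndep g ⊤ × SameAff g ⊤ f S

IsCap : ∀ {m n} → (Fin m → V n) → Subset m → Set
IsCap f S = ∀ T → T ⊆ S → ∣ T ∣ ≡ 4 → sumOver f T ≢ 𝟎

IsBasis : ∀ {m n} → (Fin m → V n) → Subset m → Subset m → Set
IsBasis f S B = B ⊆ S × AffIndep f B × SameAff f B f S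

-- T is B_x: the (unique) subset of B whose elements sum to x
-- (as an affine combination, i.e. of odd size)
IsBx : ∀ {m n} → (Fin m → V n) → Subset m → Fin m → Subset m → Set
IsBx f B x T = T ⊆ B × Odd ∣ T ∣ × sumOver f T ≡ f x

Type5555 : ∀ {m n} → (Fin m → V n) → Subset m → Subset m → Set
Type5555 f S B =
  ∣ S ─ B ∣ ≡ 4 × (∀ x → x ∈ S ─ B → ∃ λ T → IsBx f B x T × ∣ T ∣ ≡ 5)

-- the six unordered pairs {i,j} ⊆ {1,2,3,4} (0-indexed), as i < j
pairs6 : List (Fin 4 × Fin 4)
pairs6 = (0F , 1F) ∷ (0F , 2F) ∷ (0F , 3F) ∷ (1F , 2F) ∷ (1F , 3F) ∷ (2F , 3F) ∷ []
  where
  0F 1F 2F 3F : Fin 4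
  0F = zero
  1F = suc zero
  2F = suc (suc zero)
  3F = suc (suc (suc zero))

count2 : (Fin 4 → Fin 4 → ℕ) → ℕ
count2 s = length (filter (λ p → s (Data.Product.proj₁ p) (Data.Product.proj₂ p) ℕ.≟ 2) pairs6)

module Submission where

-- Over ℤ₂ a set is affinely independent iff none of its nonempty subsets of even size sums to 0.
-- For a basis B of C and distinct points x₁,…,x_k ∉ B, the set B_{x₁} ⊕ ⋯ ⊕ B_{x_k} ⊕ {x₁,…,x_k}
-- therefore sums to 0, and in a cap of distinct points it has neither 2 nor 4 elements. Since
-- dim C = 7, B has 8 points, and inclusion–exclusion inside B turns these exclusions into:
-- |B_x| ∈ {5,7} with at most one 7; |B_x ∩ B_y| ∈ {2,3} when |B_x| = |B_y| = 5; two intersections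
-- of size 2 never share an index; not all six intersections have size 3. If some |B_y| = 7,
-- exchanging a point of B_y ∩ B_{y′} for a second dependent point y′ gives a basis of type 5-5-5-5.

open import Defs
open import Algebra.Properties.CommutativeSemigroup using (interchange)
open import Data.Bool using (Bool; true; false; if_then_else_; _∧_; _∨_; _xor_)
import Data.Bool as Bool
open import Data.Bool.Properties using (xor-assoc; xor-comm; xor-identityˡ; xor-identityʳ; xor-same; ¬-not)
open import Data.Empty using (⊥; ⊥-elim)
open import Data.Fin using (Fin; zero; suc; _≟_)
open import Data.Fin.Properties using (any?)
open import Data.Fin.Subset using (Subset; ⁅_⁆; ⊤; _∈_; _∉_; _⊆_; _∩_; _∪_; _─_; _-_; ∣_∣) renaming (⊥ to ∅)
open import Data.Fin.Subset.Properties
  using (drop-there; ∉⊥; ∈⊤; ⊥⊆; ⊆⊤; ⊆-antisym; x∈⁅x⁆; x∈⁅y⁆⇒x≡y; x≢y⇒x∉⁅y⁆; ∣⁅x⁆∣≡1; ∣⊥∣≡0; Empty-unique; nonempty?;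
         _∈?_; x∈p∩q⁻; x∈p∪q⁺; x∈p∪q⁻; x∉⁅y⁆⇒x≢y; x∈p∧x≢y⇒x∈p-y; x∈p∧x∉q⇒x∈p─q; p─q⊆p; ∩-comm; p⊆q⇒∣p∣≤∣q∣; ∣p∩q∣≤∣p∣)
open import Data.List using (List; []; _∷_; _++_)
import Data.List as List
open import Data.Nat using (ℕ; zero; suc; _+_; _*_; _∸_; _≤_; parity)
import Data.Nat as ℕ
open import Data.Nat.Properties
  using (+-comm; +-suc; +-cancelʳ-≡; +-cancelˡ-≡; m+n∸m≡n; suc-injective; ≤-trans; ≤-reflexive; ≤⇒≤ᵇ; +-commutativeSemigroup)
open import Data.Nat.Tactic.RingSolver using (solve-∀)
open import Data.Parity.Base as ℙ using (0ℙ; 1ℙ)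
open import Data.Parity.Properties using (+-homo-+; *-homo-*; p+p≡0ℙ)
open import Data.Product using (∃; _×_; _,_; proj₁; proj₂)
import Data.Product as Product
open import Data.Sum using (_⊎_; inj₁; inj₂; [_,_]′)
import Data.Sum as Sum
open import Data.Vec using (Vec; []; _∷_; here; there; lookup; map; head; tail)
open import Data.Vec.Properties using (zipWith-assoc; zipWith-comm; zipWith-identityˡ; zipWith-identityʳ; lookup-map)
open import Function using (_∘_; id; Equivalence)
open import Function.Bundles using (mk⇔)
open import Function.Definitions using (Injective)
open import Relation.Nullary using (¬_; Dec; yes; no; does; contradiction; map′; _×-dec_)
open import Relation.Nullary.Decidable using (True; toWitness)
open import Relation.Binary.PropositionalEquality

-- Sums of subfamilies in ℤ₂ⁿ

⊕-assoc : ∀ {n} (u v w : V n) → u ⊕ v ⊕ w ≡ u ⊕ (v ⊕ w)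
⊕-assoc = zipWith-assoc xor-assoc

⊕-comm : ∀ {n} (u v : V n) → u ⊕ v ≡ v ⊕ u
⊕-comm = zipWith-comm xor-comm

⊕-identityˡ : ∀ {n} (u : V n) → 𝟎 ⊕ u ≡ u
⊕-identityˡ = zipWith-identityˡ xor-identityˡ

⊕-identityʳ : ∀ {n} (u : V n) → u ⊕ 𝟎 ≡ u
⊕-identityʳ = zipWith-identityʳ xor-identityʳ

⊕-self : ∀ {n} (u : V n) → u ⊕ u ≡ 𝟎
⊕-self []      = refl
⊕-self (a ∷ u) = cong₂ _∷_ (xor-same a) (⊕-self u)

⊕≡𝟎⇒≡ : ∀ {n} {u v : V n} → u ⊕ v ≡ 𝟎 → u ≡ v
⊕≡𝟎⇒≡ {u = u} {v} eq = begin
  u            ≡⟨ ⊕-identityʳ u ⟨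
  u ⊕ 𝟎        ≡⟨ cong (u ⊕_) (⊕-self v) ⟨
  u ⊕ (v ⊕ v)  ≡⟨ ⊕-assoc u v v ⟨
  u ⊕ v ⊕ v    ≡⟨ cong (_⊕ v) eq ⟩
  𝟎 ⊕ v        ≡⟨ ⊕-identityˡ v ⟩
  v            ∎
  where open ≡-Reasoning

⊕-interchange : ∀ {n} (u v w x : V n) → u ⊕ v ⊕ (w ⊕ x) ≡ u ⊕ w ⊕ (v ⊕ x)
⊕-interchange u v w x = begin
  u ⊕ v ⊕ (w ⊕ x)    ≡⟨ ⊕-assoc u v (w ⊕ x) ⟩
  u ⊕ (v ⊕ (w ⊕ x))  ≡⟨ cong (u ⊕_) (⊕-assoc v w x) ⟨
  u ⊕ (v ⊕ w ⊕ x)    ≡⟨ cong (λ z → u ⊕ (z ⊕ x)) (⊕-comm v w) ⟩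
  u ⊕ (w ⊕ v ⊕ x)    ≡⟨ cong (u ⊕_) (⊕-assoc w v x) ⟩
  u ⊕ (w ⊕ (v ⊕ x))  ≡⟨ ⊕-assoc u w (v ⊕ x) ⟨
  u ⊕ w ⊕ (v ⊕ x)    ∎
  where open ≡-Reasoning

_·_ : ∀ {n} → Bool → V n → V n
b · u = if b then u else 𝟎

·-distribʳ-xor : ∀ {n} b c (u : V n) → (b xor c) · u ≡ b · u ⊕ c · u
·-distribʳ-xor false c     u = sym (⊕-identityˡ (c · u))
·-distribʳ-xor true  false u = sym (⊕-identityʳ u)
·-distribʳ-xor true  true  u = sym (⊕-self u)

sumOver-⊕ : ∀ {m n} (f : Fin m → V n) (T U : Subset m) →
            sumOver f (T ⊕ U) ≡ sumOver f T ⊕ sumOver f U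
sumOver-⊕ f []      []      = sym (⊕-self 𝟎)
sumOver-⊕ f (b ∷ T) (c ∷ U) = begin
  (b xor c) · f zero ⊕ sumOver (f ∘ suc) (T ⊕ U)
    ≡⟨ cong₂ _⊕_ (·-distribʳ-xor b c (f zero)) (sumOver-⊕ (f ∘ suc) T U) ⟩
  b · f zero ⊕ c · f zero ⊕ (sumOver (f ∘ suc) T ⊕ sumOver (f ∘ suc) U)
    ≡⟨ ⊕-interchange (b · f zero) (c · f zero) _ _ ⟩
  b · f zero ⊕ sumOver (f ∘ suc) T ⊕ (c · f zero ⊕ sumOver (f ∘ suc) U) ∎
  where open ≡-Reasoning

sumOver-∅ : ∀ {m n} (f : Fin m → V n) → sumOver f ∅ ≡ 𝟎
sumOver-∅ {zero}  f = refl
sumOver-∅ {suc m} f = trans (⊕-identityˡ _) (sumOver-∅ (f ∘ suc))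

sumOver-⁅⁆ : ∀ {m n} (f : Fin m → V n) i → sumOver f ⁅ i ⁆ ≡ f i
sumOver-⁅⁆ f zero    = trans (cong (f zero ⊕_) (sumOver-∅ (f ∘ suc))) (⊕-identityʳ (f zero))
sumOver-⁅⁆ f (suc i) = trans (⊕-identityˡ _) (sumOver-⁅⁆ (f ∘ suc) i)

sumOver-cong : ∀ {m n} {f g : Fin m → V n} → (∀ i → f i ≡ g i) → ∀ T → sumOver f T ≡ sumOver g T
sumOver-cong f≗g []      = refl
sumOver-cong f≗g (b ∷ T) = cong₂ (λ u → _⊕_ (b · u)) (f≗g zero) (sumOver-cong (f≗g ∘ suc) T)

sumOver-homo : ∀ {m n k} (φ : V n → V k) → φ 𝟎 ≡ 𝟎 → (∀ u v → φ (u ⊕ v) ≡ φ u ⊕ φ v) →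
               (f : Fin m → V n) → ∀ T → sumOver (φ ∘ f) T ≡ φ (sumOver f T)
sumOver-homo φ φ𝟎 φ⊕ f []      = sym φ𝟎
sumOver-homo φ φ𝟎 φ⊕ f (b ∷ T) = begin
  b · φ (f zero) ⊕ sumOver (φ ∘ f ∘ suc) T ≡⟨ cong₂ _⊕_ (φ· b) (sumOver-homo φ φ𝟎 φ⊕ (f ∘ suc) T) ⟩
  φ (b · f zero) ⊕ φ (sumOver (f ∘ suc) T) ≡⟨ φ⊕ _ _ ⟨
  φ (b · f zero ⊕ sumOver (f ∘ suc) T)     ∎
  where
  open ≡-Reasoning
  φ· : ∀ b → b · φ (f zero) ≡ φ (b · f zero)
  φ· false = sym φ𝟎
  φ· true  = refl

sumOver-sumOver : ∀ {k m n} (f : Fin m → V n) (g : Fin k → Subset m) T →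
                  sumOver f (sumOver g T) ≡ sumOver (sumOver f ∘ g) T
sumOver-sumOver f g T = sym (sumOver-homo (sumOver f) (sumOver-∅ f) (sumOver-⊕ f) g T)

sumOver-singletons : ∀ {m} (T : Subset m) → sumOver ⁅_⁆ T ≡ T
sumOver-singletons []      = refl
sumOver-singletons (b ∷ T) = begin
  b · ⁅ zero ⁆ ⊕ sumOver (⁅_⁆ ∘ suc) T  ≡⟨ cong (b · ⁅ zero ⁆ ⊕_) (sumOver-homo (false ∷_) refl (λ _ _ → refl) ⁅_⁆ T) ⟩
  b · ⁅ zero ⁆ ⊕ (false ∷ sumOver ⁅_⁆ T) ≡⟨ cong (b · ⁅ zero ⁆ ⊕_) (cong (false ∷_) (sumOver-singletons T)) ⟩
  b · ⁅ zero ⁆ ⊕ (false ∷ T)             ≡⟨ head-summand b ⟩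
  b ∷ T                                  ∎
  where
  open ≡-Reasoning
  head-summand : ∀ b → b · ⁅ zero ⁆ ⊕ (false ∷ T) ≡ b ∷ T
  head-summand false = cong (false ∷_) (⊕-identityˡ T)
  head-summand true  = cong (true ∷_) (⊕-identityˡ T)

-- Cardinalities of Boolean combinations of sets

infixr 7 _∧ᶠ_
infixr 6 _∨ᶠ_
infixl 6 _⊕ᶠ_

data Formula (k : ℕ) : Set where
  var : Fin k → Formula k
  _∧ᶠ_ _∨ᶠ_ _⊕ᶠ_ : Formula k → Formula k → Formula k

eval : ∀ {k} → Formula k → Vec Bool k → Bool
eval (var i)  β = lookup β i
eval (φ ∧ᶠ ψ) β = eval φ β ∧ eval ψ β
eval (φ ∨ᶠ ψ) β = eval φ β ∨ eval ψ β
eval (φ ⊕ᶠ ψ) β = eval φ β xor eval ψ β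

⟦_⟧ : ∀ {k m} → Formula k → Vec (Subset m) k → Subset m
⟦ var i  ⟧ A = lookup A i
⟦ φ ∧ᶠ ψ ⟧ A = ⟦ φ ⟧ A ∩ ⟦ ψ ⟧ A
⟦ φ ∨ᶠ ψ ⟧ A = ⟦ φ ⟧ A ∪ ⟦ ψ ⟧ A
⟦ φ ⊕ᶠ ψ ⟧ A = ⟦ φ ⟧ A ⊕ ⟦ ψ ⟧ A

Σ∣_∣ : ∀ {k m} → List (Formula k) → Vec (Subset m) k → ℕ
Σ∣ []     ∣ A = 0
Σ∣ φ ∷ φs ∣ A = ∣ ⟦ φ ⟧ A ∣ + Σ∣ φs ∣ A

weight : ∀ {k} → List (Formula k) → Vec Bool k → ℕ
weight []       β = 0
weight (φ ∷ φs) β = (if eval φ β then 1 else 0) + weight φs β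

all? : ∀ {k} {P : Vec Bool k → Set} → (∀ β → Dec (P β)) → Dec (∀ β → P β)
all? {zero}  P? = map′ (λ p → λ { [] → p }) (λ p → p []) (P? [])
all? {suc k} P? = map′ (λ (p , q) → λ { (true ∷ β) → p β ; (false ∷ β) → q β })
                       (λ p → (λ β → p (true ∷ β)) , (λ β → p (false ∷ β)))
                       (all? (λ β → P? (true ∷ β)) ×-dec all? (λ β → P? (false ∷ β)))

⟦⟧-∷ : ∀ {k m} (φ : Formula k) (A : Vec (Subset (suc m)) k) →
       ⟦ φ ⟧ A ≡ eval φ (map head A) ∷ ⟦ φ ⟧ (map tail A)
⟦⟧-∷ (var i)  A with lookup A i in eq
... | b ∷ p = cong₂ _∷_ (trans (cong head (sym eq)) (sym (lookup-map i head A)))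
                        (trans (cong tail (sym eq)) (sym (lookup-map i tail A)))
⟦⟧-∷ (φ ∧ᶠ ψ) A rewrite ⟦⟧-∷ φ A | ⟦⟧-∷ ψ A = refl
⟦⟧-∷ (φ ∨ᶠ ψ) A rewrite ⟦⟧-∷ φ A | ⟦⟧-∷ ψ A = refl
⟦⟧-∷ (φ ⊕ᶠ ψ) A rewrite ⟦⟧-∷ φ A | ⟦⟧-∷ ψ A = refl

∣∷∣ : ∀ {m} b (p : Subset m) → ∣ b ∷ p ∣ ≡ (if b then 1 else 0) + ∣ p ∣
∣∷∣ true  p = refl
∣∷∣ false p = refl

Σ∣∣-∷ : ∀ {k m} (φs : List (Formula k)) (A : Vec (Subset (suc m)) k) →
        Σ∣ φs ∣ A ≡ weight φs (map head A) + Σ∣ φs ∣ (map tail A)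
Σ∣∣-∷ []       A = refl
Σ∣∣-∷ (φ ∷ φs) A = begin
  ∣ ⟦ φ ⟧ A ∣ + Σ∣ φs ∣ A
    ≡⟨ cong₂ _+_ (trans (cong ∣_∣ (⟦⟧-∷ φ A)) (∣∷∣ (eval φ (map head A)) (⟦ φ ⟧ (map tail A)))) (Σ∣∣-∷ φs A) ⟩
  ((if eval φ (map head A) then 1 else 0) + ∣ ⟦ φ ⟧ (map tail A) ∣) + (weight φs (map head A) + Σ∣ φs ∣ (map tail A))
    ≡⟨ interchange +-commutativeSemigroup (if eval φ (map head A) then 1 else 0) ∣ ⟦ φ ⟧ (map tail A) ∣ _ _ ⟩
  weight (φ ∷ φs) (map head A) + Σ∣ φ ∷ φs ∣ (map tail A) ∎
  where open ≡-Reasoning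

Σ∣∣-[] : ∀ {k} (φs : List (Formula k)) (A : Vec (Subset 0) k) → Σ∣ φs ∣ A ≡ 0
Σ∣∣-[] []       A = refl
Σ∣∣-[] (φ ∷ φs) A with ⟦ φ ⟧ A
... | [] = Σ∣∣-[] φs A

venn-sound : ∀ {k m} (φs ψs : List (Formula k)) → (∀ β → weight φs β ≡ weight ψs β) →
             (A : Vec (Subset m) k) → Σ∣ φs ∣ A ≡ Σ∣ ψs ∣ A
venn-sound {m = zero}  φs ψs w A = trans (Σ∣∣-[] φs A) (sym (Σ∣∣-[] ψs A))
venn-sound {m = suc m} φs ψs w A = begin
  Σ∣ φs ∣ A                                        ≡⟨ Σ∣∣-∷ φs A ⟩
  weight φs (map head A) + Σ∣ φs ∣ (map tail A)    ≡⟨ cong₂ _+_ (w _) (venn-sound φs ψs w (map tail A)) ⟩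
  weight ψs (map head A) + Σ∣ ψs ∣ (map tail A)    ≡⟨ Σ∣∣-∷ ψs A ⟨
  Σ∣ ψs ∣ A                                        ∎
  where open ≡-Reasoning

-- A linear identity between cardinalities of Boolean combinations of sets holds as soon as it
-- holds for one-point sets; venn checks the latter by evaluation.
venn : ∀ {k m} (φs ψs : List (Formula k)) → {True (all? (λ β → weight φs β ℕ.≟ weight ψs β))} →
       (A : Vec (Subset m) k) → Σ∣ φs ∣ A ≡ Σ∣ ψs ∣ A
venn φs ψs {pointwise} = venn-sound φs ψs (toWitness pointwise)

-- Each identity below is checked pointwise by venn; solve-∀ only converts between the stated form
-- and the right-nested sums computed by Σ∣_∣.
module InclusionExclusion {m : ℕ} where

  private
    x : ∀ {k} → Formula (1 + k)
    x = var zero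
    y : ∀ {k} → Formula (2 + k)
    y = var (suc zero)
    z : ∀ {k} → Formula (3 + k)
    z = var (suc (suc zero))
    w : ∀ {k} → Formula (4 + k)
    w = var (suc (suc (suc zero)))

  ∣∪∣-incl-excl₂ : ∀ (X Y : Subset m) → ∣ X ∩ Y ∣ + ∣ X ∪ Y ∣ ≡ ∣ X ∣ + ∣ Y ∣
  ∣∪∣-incl-excl₂ X Y =
    trans (shape (∣ X ∩ Y ∣) (∣ X ∪ Y ∣))
          (trans (venn (x ∧ᶠ y ∷ x ∨ᶠ y ∷ []) (x ∷ y ∷ []) (X ∷ Y ∷ [])) (sym (shape (∣ X ∣) (∣ Y ∣))))
    where
    shape : ∀ (a b : ℕ) → a + b ≡ a + (b + 0)
    shape = solve-∀

  ∣⊕∣-incl-excl₂ : ∀ (X Y : Subset m) → 2 * ∣ X ∩ Y ∣ + ∣ X ⊕ Y ∣ ≡ ∣ X ∣ + ∣ Y ∣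
  ∣⊕∣-incl-excl₂ X Y =
    trans (shapeˡ (∣ X ∩ Y ∣) (∣ X ⊕ Y ∣))
          (trans (venn (x ∧ᶠ y ∷ x ∧ᶠ y ∷ x ⊕ᶠ y ∷ []) (x ∷ y ∷ []) (X ∷ Y ∷ [])) (sym (shapeʳ (∣ X ∣) (∣ Y ∣))))
    where
    shapeˡ : ∀ (p d : ℕ) → 2 * p + d ≡ p + (p + (d + 0))
    shapeˡ = solve-∀
    shapeʳ : ∀ (a b : ℕ) → a + b ≡ a + (b + 0)
    shapeʳ = solve-∀

  ∣∪∣-incl-excl₃ : ∀ (X Y Z : Subset m) →
    ∣ X ∩ Y ∣ + ∣ X ∩ Z ∣ + ∣ Y ∩ Z ∣ + ∣ X ∪ Y ∪ Z ∣ ≡ ∣ X ∣ + ∣ Y ∣ + ∣ Z ∣ + ∣ X ∩ Y ∩ Z ∣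
  ∣∪∣-incl-excl₃ X Y Z =
    trans (shape (∣ X ∩ Y ∣) (∣ X ∩ Z ∣) (∣ Y ∩ Z ∣) (∣ X ∪ Y ∪ Z ∣))
          (trans (venn (x ∧ᶠ y ∷ x ∧ᶠ z ∷ y ∧ᶠ z ∷ x ∨ᶠ y ∨ᶠ z ∷ []) (x ∷ y ∷ z ∷ x ∧ᶠ y ∧ᶠ z ∷ []) (X ∷ Y ∷ Z ∷ []))
                 (sym (shape (∣ X ∣) (∣ Y ∣) (∣ Z ∣) (∣ X ∩ Y ∩ Z ∣))))
    where
    shape : ∀ (a b c d : ℕ) → a + b + c + d ≡ a + (b + (c + (d + 0)))
    shape = solve-∀

  ∣⊕∣-incl-excl₃ : ∀ (X Y Z : Subset m) →
    2 * (∣ X ∩ Y ∣ + ∣ X ∩ Z ∣ + ∣ Y ∩ Z ∣) + ∣ X ⊕ Y ⊕ Z ∣ ≡ ∣ X ∣ + ∣ Y ∣ + ∣ Z ∣ + 4 * ∣ X ∩ Y ∩ Z ∣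
  ∣⊕∣-incl-excl₃ X Y Z =
    trans (shapeˡ (∣ X ∩ Y ∣) (∣ X ∩ Z ∣) (∣ Y ∩ Z ∣) (∣ X ⊕ Y ⊕ Z ∣))
          (trans (venn (pairs ++ pairs ++ (x ⊕ᶠ y ⊕ᶠ z ∷ [])) (x ∷ y ∷ z ∷ List.replicate 4 (x ∧ᶠ y ∧ᶠ z)) (X ∷ Y ∷ Z ∷ []))
                 (sym (shapeʳ (∣ X ∣) (∣ Y ∣) (∣ Z ∣) (∣ X ∩ Y ∩ Z ∣))))
    where
    pairs : List (Formula 3)
    pairs = x ∧ᶠ y ∷ x ∧ᶠ z ∷ y ∧ᶠ z ∷ []
    shapeˡ : ∀ (a b c d : ℕ) → 2 * (a + b + c) + d ≡ a + (b + (c + (a + (b + (c + (d + 0))))))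
    shapeˡ = solve-∀
    shapeʳ : ∀ (a b c t : ℕ) → a + b + c + 4 * t ≡ a + (b + (c + (t + (t + (t + (t + 0))))))
    shapeʳ = solve-∀

  ∣∪∣-incl-excl₄ : ∀ (X Y Z W : Subset m) →
    ∣ X ∩ Y ∣ + ∣ X ∩ Z ∣ + ∣ X ∩ W ∣ + ∣ Y ∩ Z ∣ + ∣ Y ∩ W ∣ + ∣ Z ∩ W ∣ + ∣ X ∩ Y ∩ Z ∩ W ∣
      + ∣ X ∪ Y ∪ Z ∪ W ∣
    ≡ ∣ X ∣ + ∣ Y ∣ + ∣ Z ∣ + ∣ W ∣ + (∣ X ∩ Y ∩ Z ∣ + ∣ X ∩ Y ∩ W ∣ + ∣ X ∩ Z ∩ W ∣ + ∣ Y ∩ Z ∩ W ∣)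
  ∣∪∣-incl-excl₄ X Y Z W =
    trans (shapeˡ (∣ X ∩ Y ∣) (∣ X ∩ Z ∣) (∣ X ∩ W ∣) (∣ Y ∩ Z ∣) (∣ Y ∩ W ∣) (∣ Z ∩ W ∣) (∣ X ∩ Y ∩ Z ∩ W ∣) (∣ X ∪ Y ∪ Z ∪ W ∣))
          (trans (venn (pairs ++ x ∧ᶠ y ∧ᶠ z ∧ᶠ w ∷ x ∨ᶠ y ∨ᶠ z ∨ᶠ w ∷ []) (x ∷ y ∷ z ∷ w ∷ triples) (X ∷ Y ∷ Z ∷ W ∷ []))
                 (sym (shapeʳ (∣ X ∣) (∣ Y ∣) (∣ Z ∣) (∣ W ∣) (∣ X ∩ Y ∩ Z ∣) (∣ X ∩ Y ∩ W ∣) (∣ X ∩ Z ∩ W ∣) (∣ Y ∩ Z ∩ W ∣))))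
    where
    pairs triples : List (Formula 4)
    pairs = x ∧ᶠ y ∷ x ∧ᶠ z ∷ x ∧ᶠ w ∷ y ∧ᶠ z ∷ y ∧ᶠ w ∷ z ∧ᶠ w ∷ []
    triples = x ∧ᶠ y ∧ᶠ z ∷ x ∧ᶠ y ∧ᶠ w ∷ x ∧ᶠ z ∧ᶠ w ∷ y ∧ᶠ z ∧ᶠ w ∷ []
    shapeˡ : ∀ (a b c d e f q u : ℕ) →
      a + b + c + d + e + f + q + u ≡ a + (b + (c + (d + (e + (f + (q + (u + 0)))))))
    shapeˡ = solve-∀
    shapeʳ : ∀ (a b c d e f g h : ℕ) →
      a + b + c + d + (e + f + g + h) ≡ a + (b + (c + (d + (e + (f + (g + (h + 0)))))))
    shapeʳ = solve-∀

  ∣⊕∣-incl-excl₄ : ∀ (X Y Z W : Subset m) →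
    2 * (∣ X ∩ Y ∣ + ∣ X ∩ Z ∣ + ∣ X ∩ W ∣ + ∣ Y ∩ Z ∣ + ∣ Y ∩ W ∣ + ∣ Z ∩ W ∣) + 8 * ∣ X ∩ Y ∩ Z ∩ W ∣
      + ∣ X ⊕ Y ⊕ Z ⊕ W ∣
    ≡ ∣ X ∣ + ∣ Y ∣ + ∣ Z ∣ + ∣ W ∣ + 4 * (∣ X ∩ Y ∩ Z ∣ + ∣ X ∩ Y ∩ W ∣ + ∣ X ∩ Z ∩ W ∣ + ∣ Y ∩ Z ∩ W ∣)
  ∣⊕∣-incl-excl₄ X Y Z W =
    trans (shapeˡ (∣ X ∩ Y ∣) (∣ X ∩ Z ∣) (∣ X ∩ W ∣) (∣ Y ∩ Z ∣) (∣ Y ∩ W ∣) (∣ Z ∩ W ∣) (∣ X ∩ Y ∩ Z ∩ W ∣) (∣ X ⊕ Y ⊕ Z ⊕ W ∣))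
          (trans (venn φs ψs (X ∷ Y ∷ Z ∷ W ∷ []))
                 (sym (shapeʳ (∣ X ∣) (∣ Y ∣) (∣ Z ∣) (∣ W ∣) (∣ X ∩ Y ∩ Z ∣) (∣ X ∩ Y ∩ W ∣) (∣ X ∩ Z ∩ W ∣) (∣ Y ∩ Z ∩ W ∣))))
    where
    pairs triples φs ψs : List (Formula 4)
    pairs = x ∧ᶠ y ∷ x ∧ᶠ z ∷ x ∧ᶠ w ∷ y ∧ᶠ z ∷ y ∧ᶠ w ∷ z ∧ᶠ w ∷ []
    triples = x ∧ᶠ y ∧ᶠ z ∷ x ∧ᶠ y ∧ᶠ w ∷ x ∧ᶠ z ∧ᶠ w ∷ y ∧ᶠ z ∧ᶠ w ∷ []
    φs = pairs ++ pairs ++ List.replicate 8 (x ∧ᶠ y ∧ᶠ z ∧ᶠ w) ++ (x ⊕ᶠ y ⊕ᶠ z ⊕ᶠ w ∷ [])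
    ψs = x ∷ y ∷ z ∷ w ∷ triples ++ triples ++ triples ++ triples
    shapeˡ : ∀ (a b c d e f q s : ℕ) →
      2 * (a + b + c + d + e + f) + 8 * q + s
      ≡ a + (b + (c + (d + (e + (f + (a + (b + (c + (d + (e + (f +
          (q + (q + (q + (q + (q + (q + (q + (q + (s + 0))))))))))))))))))))
    shapeˡ = solve-∀
    shapeʳ : ∀ (a b c d e f g h : ℕ) →
      a + b + c + d + 4 * (e + f + g + h)
      ≡ a + (b + (c + (d + (e + (f + (g + (h + (e + (f + (g + (h +
          (e + (f + (g + (h + (e + (f + (g + (h + 0)))))))))))))))))))
    shapeʳ = solve-∀

open InclusionExclusion

∈⊕⁻ : ∀ {m} {i : Fin m} (p q : Subset m) → i ∈ p ⊕ q → i ∈ p × i ∉ q ⊎ i ∉ p × i ∈ q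
∈⊕⁻ (true  ∷ p) (false ∷ q) here       = inj₁ (here , λ ())
∈⊕⁻ (false ∷ p) (true  ∷ q) here       = inj₂ ((λ ()) , here)
∈⊕⁻ (_ ∷ p)     (_ ∷ q)     (there i∈) =
  Sum.map (Product.map there (_∘ drop-there)) (Product.map (_∘ drop-there) there) (∈⊕⁻ p q i∈)

∈⊕⁺ˡ : ∀ {m} {i : Fin m} {p q : Subset m} → i ∈ p → i ∉ q → i ∈ p ⊕ q
∈⊕⁺ˡ {q = true  ∷ q} here        i∉q = ⊥-elim (i∉q here)
∈⊕⁺ˡ {q = false ∷ q} here        i∉q = here
∈⊕⁺ˡ {q = _ ∷ q}     (there i∈p) i∉q = there (∈⊕⁺ˡ i∈p (i∉q ∘ there))

∈⊕⁺ʳ : ∀ {m} {i : Fin m} {p q : Subset m} → i ∉ p → i ∈ q → i ∈ p ⊕ q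
∈⊕⁺ʳ {p = p} {q} i∉p i∈q = subst (_ ∈_) (⊕-comm q p) (∈⊕⁺ˡ i∈q i∉p)

∈∈⇒∉⊕ : ∀ {m} {i : Fin m} {p q : Subset m} → i ∈ p → i ∈ q → i ∉ p ⊕ q
∈∈⇒∉⊕ {p = p} {q} i∈p i∈q i∈ with ∈⊕⁻ p q i∈
... | inj₁ (_ , i∉q) = i∉q i∈q
... | inj₂ (i∉p , _) = i∉p i∈p

x∉p⊕⁅x⁆ : ∀ {m} {x : Fin m} {p : Subset m} → x ∈ p → x ∉ p ⊕ ⁅ x ⁆
x∉p⊕⁅x⁆ {x = x} x∈p = ∈∈⇒∉⊕ x∈p (x∈⁅x⁆ x)

∉⊕⁅⁆ : ∀ {m} {x y : Fin m} {p : Subset m} → x ∉ p → x ≢ y → x ∉ p ⊕ ⁅ y ⁆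
∉⊕⁅⁆ {y = y} {p} x∉p x≢y x∈ with ∈⊕⁻ p ⁅ y ⁆ x∈
... | inj₁ (x∈p , _)   = x∉p x∈p
... | inj₂ (_ , x∈⁅y⁆) = x≢y (x∈⁅y⁆⇒x≡y y x∈⁅y⁆)

⊕-⊆ : ∀ {m} {p q r : Subset m} → p ⊆ r → q ⊆ r → p ⊕ q ⊆ r
⊕-⊆ {p = p} {q} p⊆r q⊆r i∈ with ∈⊕⁻ p q i∈
... | inj₁ (i∈p , _) = p⊆r i∈p
... | inj₂ (_ , i∈q) = q⊆r i∈q

∪-⊆ : ∀ {m} {p q r : Subset m} → p ⊆ r → q ⊆ r → p ∪ q ⊆ r
∪-⊆ {p = p} {q} p⊆r q⊆r i∈ with x∈p∪q⁻ p q i∈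
... | inj₁ i∈p = p⊆r i∈p
... | inj₂ i∈q = q⊆r i∈q

∈-· : ∀ {m} {i : Fin m} b (p : Subset m) → i ∈ b · p → i ∈ p
∈-· true  p i∈ = i∈
∈-· false p i∈ = ⊥-elim (∉⊥ i∈)

x∈p⇒⁅x⁆⊆p : ∀ {m} {x : Fin m} {p : Subset m} → x ∈ p → ⁅ x ⁆ ⊆ p
x∈p⇒⁅x⁆⊆p {x = x} {p} x∈p y∈⁅x⁆ = subst (_∈ p) (sym (x∈⁅y⁆⇒x≡y x y∈⁅x⁆)) x∈p

sumOver-⊆ : ∀ {k m} {g : Fin k → Subset m} {B : Subset m} → (∀ i → g i ⊆ B) → ∀ T → sumOver g T ⊆ B
sumOver-⊆ g⊆B []      = ⊥⊆
sumOver-⊆ g⊆B (b ∷ T) = ⊕-⊆ (λ j∈ → g⊆B zero (∈-· b _ j∈)) (sumOver-⊆ (g⊆B ∘ suc) T)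

x∈p─q⇒x∉q : ∀ {m} {x : Fin m} (p q : Subset m) → x ∈ p ─ q → x ∉ q
x∈p─q⇒x∉q (true ∷ p) (false ∷ q) here       ()
x∈p─q⇒x∉q (_ ∷ p)    (_ ∷ q)     (there x∈) (there x∈q) = x∈p─q⇒x∉q p q x∈ x∈q

x∉p-x : ∀ {m} {x : Fin m} (p : Subset m) → x ∉ p - x
x∉p-x {x = x} p x∈p-x = x∈p─q⇒x∉q p ⁅ x ⁆ x∈p-x (x∈⁅x⁆ x)

sumOver-⊕⁅⁆ : ∀ {m n} (f : Fin m → V n) T i → sumOver f (T ⊕ ⁅ i ⁆) ≡ sumOver f T ⊕ f i
sumOver-⊕⁅⁆ f T i = trans (sumOver-⊕ f T ⁅ i ⁆) (cong (sumOver f T ⊕_) (sumOver-⁅⁆ f i))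

∣⊕∣-disjoint : ∀ {m} (p q : Subset m) → (∀ {i} → i ∈ p → i ∉ q) → ∣ p ⊕ q ∣ ≡ ∣ p ∣ + ∣ q ∣
∣⊕∣-disjoint {m} p q disjoint = trans (cong (λ k → 2 * k + ∣ p ⊕ q ∣) (sym ∣p∩q∣≡0)) (∣⊕∣-incl-excl₂ p q)
  where
  ∣p∩q∣≡0 : ∣ p ∩ q ∣ ≡ 0
  ∣p∩q∣≡0 = trans (cong ∣_∣ (Empty-unique λ (i , i∈p∩q) → disjoint (proj₁ (x∈p∩q⁻ p q i∈p∩q)) (proj₂ (x∈p∩q⁻ p q i∈p∩q)))) (∣⊥∣≡0 m)

∣p⊕⁅x⁆∣-∉ : ∀ {m} {x : Fin m} {p : Subset m} → x ∉ p → ∣ p ⊕ ⁅ x ⁆ ∣ ≡ suc ∣ p ∣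
∣p⊕⁅x⁆∣-∉ {x = x} {p} x∉p = begin
  ∣ p ⊕ ⁅ x ⁆ ∣          ≡⟨ ∣⊕∣-disjoint p ⁅ x ⁆ (λ i∈p i∈⁅x⁆ → x∉p (subst (_∈ p) (x∈⁅y⁆⇒x≡y x i∈⁅x⁆) i∈p)) ⟩
  ∣ p ∣ + ∣ ⁅ x ⁆ ∣      ≡⟨ cong (∣ p ∣ +_) (∣⁅x⁆∣≡1 x) ⟩
  ∣ p ∣ + 1              ≡⟨ +-comm ∣ p ∣ 1 ⟩
  suc ∣ p ∣              ∎
  where open ≡-Reasoning

∣p⊕⁅x⁆∣-∈ : ∀ {m} {x : Fin m} {p : Subset m} → x ∈ p → suc ∣ p ⊕ ⁅ x ⁆ ∣ ≡ ∣ p ∣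
∣p⊕⁅x⁆∣-∈ {x = x} {p} x∈p = begin
  suc ∣ p ⊕ ⁅ x ⁆ ∣           ≡⟨ ∣p⊕⁅x⁆∣-∉ (x∉p⊕⁅x⁆ x∈p) ⟨
  ∣ p ⊕ ⁅ x ⁆ ⊕ ⁅ x ⁆ ∣       ≡⟨ cong ∣_∣ (trans (⊕-assoc p ⁅ x ⁆ ⁅ x ⁆) (trans (cong (p ⊕_) (⊕-self ⁅ x ⁆)) (⊕-identityʳ p))) ⟩
  ∣ p ∣                       ∎
  where open ≡-Reasoning

∣p∣≡0⇒p≡∅ : ∀ {m} (p : Subset m) → ∣ p ∣ ≡ 0 → p ≡ ∅
∣p∣≡0⇒p≡∅ []          _    = refl
∣p∣≡0⇒p≡∅ (false ∷ p) ∣p∣≡0 = cong (false ∷_) (∣p∣≡0⇒p≡∅ p ∣p∣≡0)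

∣p∣≡suc⇒nonempty : ∀ {m k} (p : Subset m) → ∣ p ∣ ≡ suc k → ∃ λ i → i ∈ p
∣p∣≡suc⇒nonempty (true  ∷ p) _    = zero , here
∣p∣≡suc⇒nonempty (false ∷ p) ∣p∣≡ = let (i , i∈p) = ∣p∣≡suc⇒nonempty p ∣p∣≡ in suc i , there i∈p

∣⊤─p∣+∣p∣≡n : ∀ {n} (p : Subset n) → ∣ ⊤ ─ p ∣ + ∣ p ∣ ≡ n
∣⊤─p∣+∣p∣≡n []          = refl
∣⊤─p∣+∣p∣≡n (true ∷ p)  = trans (+-suc ∣ ⊤ ─ p ∣ ∣ p ∣) (cong suc (∣⊤─p∣+∣p∣≡n p))
∣⊤─p∣+∣p∣≡n (false ∷ p) = cong suc (∣⊤─p∣+∣p∣≡n p)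

∣⊕∣≡ : ∀ {m a b p} (X Y : Subset m) → ∣ X ∣ ≡ a → ∣ Y ∣ ≡ b → ∣ X ∩ Y ∣ ≡ p → ∣ X ⊕ Y ∣ ≡ a + b ∸ 2 * p
∣⊕∣≡ X Y refl refl refl =
  trans (sym (m+n∸m≡n (2 * ∣ X ∩ Y ∣) ∣ X ⊕ Y ∣)) (cong (_∸ 2 * ∣ X ∩ Y ∣) (∣⊕∣-incl-excl₂ X Y))

parity-∣⊕∣ : ∀ {m} (p q : Subset m) → parity ∣ p ⊕ q ∣ ≡ parity ∣ p ∣ ℙ.+ parity ∣ q ∣
parity-∣⊕∣ p q = begin
  parity ∣ p ⊕ q ∣                       ≡⟨ cong (ℙ._+ parity ∣ p ⊕ q ∣) (*-homo-* 2 ∣ p ∩ q ∣) ⟨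
  parity (2 * ∣ p ∩ q ∣) ℙ.+ parity ∣ p ⊕ q ∣ ≡⟨ +-homo-+ (2 * ∣ p ∩ q ∣) _ ⟨
  parity (2 * ∣ p ∩ q ∣ + ∣ p ⊕ q ∣)     ≡⟨ cong parity (∣⊕∣-incl-excl₂ p q) ⟩
  parity (∣ p ∣ + ∣ q ∣)                 ≡⟨ +-homo-+ ∣ p ∣ ∣ q ∣ ⟩
  parity ∣ p ∣ ℙ.+ parity ∣ q ∣        ∎
  where open ≡-Reasoning

odd⇒parity≡1ℙ : ∀ k → Odd k → parity k ≡ 1ℙ
odd⇒parity≡1ℙ 1             _   = refl
odd⇒parity≡1ℙ (suc (suc k)) odd = odd⇒parity≡1ℙ k odd

parity≡1ℙ⇒odd : ∀ k → parity k ≡ 1ℙ → Odd k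
parity≡1ℙ⇒odd 1             _ = refl
parity≡1ℙ⇒odd (suc (suc k)) p = parity≡1ℙ⇒odd k p

parity-∣⁅⁆∣ : ∀ {m} (i : Fin m) → parity ∣ ⁅ i ⁆ ∣ ≡ 1ℙ
parity-∣⁅⁆∣ i = cong parity (∣⁅x⁆∣≡1 i)

parity-∣⊕⁅⁆∣ : ∀ {m} (T : Subset m) i → parity ∣ T ⊕ ⁅ i ⁆ ∣ ≡ parity ∣ T ∣ ℙ.+ 1ℙ
parity-∣⊕⁅⁆∣ T i = trans (parity-∣⊕∣ T ⁅ i ⁆) (cong (parity ∣ T ∣ ℙ.+_) (parity-∣⁅⁆∣ i))

parity-∣sumOver∣ : ∀ {k m} (g : Fin k → Subset m) → (∀ i → parity ∣ g i ∣ ≡ 1ℙ) →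
                   ∀ T → parity ∣ sumOver g T ∣ ≡ parity ∣ T ∣
parity-∣sumOver∣ {m = m} g odd []      = cong parity (∣⊥∣≡0 m)
parity-∣sumOver∣ {m = m} g odd (b ∷ T) = begin
  parity ∣ b · g zero ⊕ sumOver (g ∘ suc) T ∣                   ≡⟨ parity-∣⊕∣ (b · g zero) _ ⟩
  parity ∣ b · g zero ∣ ℙ.+ parity ∣ sumOver (g ∘ suc) T ∣       ≡⟨ cong₂ ℙ._+_ (summand b) (parity-∣sumOver∣ (g ∘ suc) (odd ∘ suc) T) ⟩
  parity (if b then 1 else 0) ℙ.+ parity ∣ T ∣                  ≡⟨ +-homo-+ (if b then 1 else 0) ∣ T ∣ ⟨
  parity ((if b then 1 else 0) + ∣ T ∣)                         ≡⟨ cong parity (∣∷∣ b T) ⟨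
  parity ∣ b ∷ T ∣                                              ∎
  where
  open ≡-Reasoning
  summand : ∀ b → parity ∣ b · g zero ∣ ≡ parity (if b then 1 else 0)
  summand true  = odd zero
  summand false = cong parity (∣⊥∣≡0 m)

-- Independence

-- Over ℤ₂ an affine dependency among points is a nonempty zero-sum set of even size.
EvenZeroSumFree : ∀ {m n} → (Fin m → V n) → Subset m → Set
EvenZeroSumFree f S = ∀ T → T ⊆ S → sumOver f T ≡ 𝟎 → parity ∣ T ∣ ≡ 0ℙ → T ≡ ∅

AffIndep⇒EvenZeroSumFree : ∀ {m n} (f : Fin m → V n) S → AffIndep f S → EvenZeroSumFree f S
AffIndep⇒EvenZeroSumFree f S indep T T⊆S zero-sum even with nonempty? T
... | no  empty      = Empty-unique empty
... | yes (i , i∈T) = ⊥-elim (indep i (T⊆S i∈T) (T ⊕ ⁅ i ⁆ , T-i⊆S-i , odd , sum≡fi))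
  where
  T-i⊆S-i : T ⊕ ⁅ i ⁆ ⊆ S - i
  T-i⊆S-i {j} j∈ with ∈⊕⁻ T ⁅ i ⁆ j∈
  ... | inj₁ (j∈T , j∉⁅i⁆) = x∈p∧x≢y⇒x∈p-y (T⊆S j∈T) (x∉⁅y⁆⇒x≢y j∉⁅i⁆)
  ... | inj₂ (j∉T , j∈⁅i⁆) = contradiction (subst (_∈ T) (sym (x∈⁅y⁆⇒x≡y i j∈⁅i⁆)) i∈T) j∉T
  odd : Odd ∣ T ⊕ ⁅ i ⁆ ∣
  odd = parity≡1ℙ⇒odd ∣ T ⊕ ⁅ i ⁆ ∣ (trans (parity-∣⊕⁅⁆∣ T i) (cong (ℙ._+ 1ℙ) even))
  sum≡fi : sumOver f (T ⊕ ⁅ i ⁆) ≡ f i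
  sum≡fi = trans (sumOver-⊕⁅⁆ f T i) (trans (cong (_⊕ f i) zero-sum) (⊕-identityˡ (f i)))

EvenZeroSumFree⇒AffIndep : ∀ {m n} (f : Fin m → V n) S → EvenZeroSumFree f S → AffIndep f S
EvenZeroSumFree⇒AffIndep f S free i i∈S (T , T⊆S-i , odd , sum≡fi) = ∉⊥ (subst (i ∈_) T+i≡∅ i∈T+i)
  where
  T+i≡∅ : T ⊕ ⁅ i ⁆ ≡ ∅
  T+i≡∅ = free (T ⊕ ⁅ i ⁆)
    (⊕-⊆ (p─q⊆p S ⁅ i ⁆ ∘ T⊆S-i) (x∈p⇒⁅x⁆⊆p i∈S))
    (trans (sumOver-⊕⁅⁆ f T i) (trans (cong (_⊕ f i) sum≡fi) (⊕-self (f i))))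
    (trans (parity-∣⊕⁅⁆∣ T i) (cong (ℙ._+ 1ℙ) (odd⇒parity≡1ℙ ∣ T ∣ odd)))
  i∈T+i : i ∈ T ⊕ ⁅ i ⁆
  i∈T+i = ∈⊕⁺ʳ (x∉p-x S ∘ T⊆S-i) (x∈⁅x⁆ i)

sumOver-injective : ∀ {m n} {f : Fin m → V n} {S T U : Subset m} → EvenZeroSumFree f S →
           T ⊆ S → U ⊆ S → parity ∣ T ∣ ≡ parity ∣ U ∣ → sumOver f T ≡ sumOver f U → T ≡ U
sumOver-injective {f = f} {T = T} {U} free T⊆S U⊆S same-parity same-sum = ⊕≡𝟎⇒≡ (free (T ⊕ U) (⊕-⊆ T⊆S U⊆S)
  (trans (sumOver-⊕ f T U) (trans (cong (_⊕ sumOver f U) same-sum) (⊕-self (sumOver f U))))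
  (trans (parity-∣⊕∣ T U) (trans (cong (ℙ._+ parity ∣ U ∣) same-parity) (p+p≡0ℙ (parity ∣ U ∣)))))

LinIndep : ∀ {N m} → (Fin N → V m) → Subset N → Set
LinIndep f B = ∀ T → T ⊆ B → sumOver f T ≡ 𝟎 → T ≡ ∅

InSpan : ∀ {N m} → (Fin N → V m) → Subset N → V m → Set
InSpan f B v = ∃ λ T → T ⊆ B × sumOver f T ≡ v

Spanning : ∀ {N m} → (Fin N → V m) → Set
Spanning f = ∀ v → ∃ λ T → sumOver f T ≡ v

head-⊕ : ∀ {m} (u v : V (suc m)) → head (u ⊕ v) ≡ head u xor head v
head-⊕ (a ∷ u) (b ∷ v) = refl

tail-⊕ : ∀ {m} (u v : V (suc m)) → tail (u ⊕ v) ≡ tail u ⊕ tail v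
tail-⊕ (a ∷ u) (b ∷ v) = refl

head-· : ∀ {m} b (v : V (suc m)) → head (b · v) ≡ b ∧ head v
head-· true  v = refl
head-· false v = refl

sumOver-·⁅⁆ : ∀ {N m} (f : Fin N → V m) b i → sumOver f (b · ⁅ i ⁆) ≡ b · f i
sumOver-·⁅⁆ f true  i = sumOver-⁅⁆ f i
sumOver-·⁅⁆ f false i = sumOver-∅ f

head-sumOver : ∀ {N m} (f : Fin N → V (suc m)) → (∀ i → head (f i) ≡ false) →
               ∀ T → head (sumOver f T) ≡ false
head-sumOver f heads []      = refl
head-sumOver f heads (b ∷ T) =
  trans (head-⊕ (b · f zero) _) (cong₂ _xor_ (summand b) (head-sumOver (f ∘ suc) (heads ∘ suc) T))
  where
  summand : ∀ b → head (b · f zero) ≡ false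
  summand true  = heads zero
  summand false = refl

pivot : ∀ {N m} (f : Fin N → V (suc m)) → Spanning f → ∃ λ p → head (f p) ≡ true
pivot f spanning with any? (λ i → head (f i) Bool.≟ true)
... | yes found = found
... | no  none  with spanning (true ∷ 𝟎)
...   | T , sum≡e₀ = contradiction (trans (sym (cong head sum≡e₀)) (head-sumOver f (λ i → ¬-not (λ h → none (i , h))) T)) λ ()

-- Gaussian elimination of the first coordinate.
module Elimination {N m} (f : Fin N → V (suc m)) (p : Fin N) (pivot-head : head (f p) ≡ true) where

  eliminate : V (suc m) → V m
  eliminate v = tail (v ⊕ head v · f p)

  eliminate-𝟎 : eliminate 𝟎 ≡ 𝟎
  eliminate-𝟎 = ⊕-identityˡ 𝟎

  eliminate-⊕ : ∀ u v → eliminate (u ⊕ v) ≡ eliminate u ⊕ eliminate v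
  eliminate-⊕ u v = begin
    tail (u ⊕ v ⊕ head (u ⊕ v) · f p)                     ≡⟨ cong (λ b → tail (u ⊕ v ⊕ b · f p)) (head-⊕ u v) ⟩
    tail (u ⊕ v ⊕ (head u xor head v) · f p)              ≡⟨ cong (λ w → tail (u ⊕ v ⊕ w)) (·-distribʳ-xor (head u) (head v) (f p)) ⟩
    tail (u ⊕ v ⊕ (head u · f p ⊕ head v · f p))          ≡⟨ cong tail (⊕-interchange u v _ _) ⟩
    tail (u ⊕ head u · f p ⊕ (v ⊕ head v · f p))          ≡⟨ tail-⊕ (u ⊕ head u · f p) _ ⟩
    eliminate u ⊕ eliminate v                             ∎
    where open ≡-Reasoning

  eliminate-pivot : eliminate (f p) ≡ 𝟎
  eliminate-pivot = trans (cong (λ b → tail (f p ⊕ b · f p)) pivot-head) (cong tail (⊕-self (f p)))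

  eliminate≡𝟎 : ∀ v → eliminate v ≡ 𝟎 → v ≡ head v · f p
  eliminate≡𝟎 v elim≡𝟎 = ⊕≡𝟎⇒≡ (begin
    v ⊕ head v · f p                                   ≡⟨ η (v ⊕ head v · f p) ⟩
    head (v ⊕ head v · f p) ∷ eliminate v              ≡⟨ cong₂ _∷_ head≡false elim≡𝟎 ⟩
    𝟎                                                  ∎)
    where
    open ≡-Reasoning
    η : ∀ (w : V (suc m)) → w ≡ head w ∷ tail w
    η (a ∷ w) = refl
    head≡false : head (v ⊕ head v · f p) ≡ false
    head≡false = begin
      head (v ⊕ head v · f p)          ≡⟨ head-⊕ v _ ⟩
      head v xor head (head v · f p)   ≡⟨ cong (head v xor_) (trans (head-· (head v) (f p)) (cong (head v ∧_) pivot-head)) ⟩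
      head v xor (head v ∧ true)       ≡⟨ lemma (head v) ⟩
      false                            ∎
      where
      lemma : ∀ b → b xor (b ∧ true) ≡ false
      lemma false = refl
      lemma true  = refl

  f′ : Fin N → V m
  f′ = eliminate ∘ f

  sumOver-f′ : ∀ T → sumOver f′ T ≡ eliminate (sumOver f T)
  sumOver-f′ = sumOver-homo eliminate eliminate-𝟎 eliminate-⊕ f

  f′-spanning : Spanning f → Spanning f′
  f′-spanning spanning w with spanning (false ∷ w)
  ... | T , sum≡ = T , trans (sumOver-f′ T) (trans (cong eliminate sum≡) (⊕-identityʳ w))

  module _ {B′ : Subset N} (indep′ : LinIndep f′ B′) where

    p∉B′ : p ∉ B′
    p∉B′ p∈B′ = ∉⊥ (subst (p ∈_) (indep′ ⁅ p ⁆ (x∈p⇒⁅x⁆⊆p p∈B′) (trans (sumOver-⁅⁆ f′ p) eliminate-pivot)) (x∈⁅x⁆ p))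

    ∈B′ : ∀ {j} → j ∈ ⁅ p ⁆ ⊕ B′ → j ≢ p → j ∈ B′
    ∈B′ {j} j∈B j≢p with ∈⊕⁻ ⁅ p ⁆ B′ j∈B
    ... | inj₁ (j∈⁅p⁆ , _) = contradiction (x∈⁅y⁆⇒x≡y p j∈⁅p⁆) j≢p
    ... | inj₂ (_ , j∈B′)  = j∈B′

    disjoint : ∀ {j} → j ∈ ⁅ p ⁆ → j ∉ B′
    disjoint j∈⁅p⁆ j∈B′ = p∉B′ (subst (_∈ B′) (x∈⁅y⁆⇒x≡y p j∈⁅p⁆) j∈B′)

    ⁅p⁆⊆B : ⁅ p ⁆ ⊆ ⁅ p ⁆ ⊕ B′
    ⁅p⁆⊆B j∈⁅p⁆ = ∈⊕⁺ˡ j∈⁅p⁆ (disjoint j∈⁅p⁆)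

    B′⊆B : B′ ⊆ ⁅ p ⁆ ⊕ B′
    B′⊆B j∈B′ = ∈⊕⁺ʳ (λ j∈⁅p⁆ → disjoint j∈⁅p⁆ j∈B′) j∈B′

    ∣B∣≡1+∣B′∣ : ∣ ⁅ p ⁆ ⊕ B′ ∣ ≡ suc ∣ B′ ∣
    ∣B∣≡1+∣B′∣ = trans (∣⊕∣-disjoint ⁅ p ⁆ B′ disjoint) (cong (_+ ∣ B′ ∣) (∣⁅x⁆∣≡1 p))

    indep : LinIndep f (⁅ p ⁆ ⊕ B′)
    indep T T⊆B sum≡𝟎 with p ∈? T
    ... | no  p∉T = indep′ T (λ j∈T → ∈B′ (T⊆B j∈T) λ { refl → p∉T j∈T }) sum′≡𝟎
      where
      sum′≡𝟎 : sumOver f′ T ≡ 𝟎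
      sum′≡𝟎 = trans (sumOver-f′ T) (trans (cong eliminate sum≡𝟎) eliminate-𝟎)
    ... | yes p∈T = contradiction (trans (sym (cong head fp≡𝟎)) pivot-head) λ ()
      where
      T-p⊆B′ : T ⊕ ⁅ p ⁆ ⊆ B′
      T-p⊆B′ j∈ with ∈⊕⁻ T ⁅ p ⁆ j∈
      ... | inj₁ (j∈T , j∉⁅p⁆) = ∈B′ (T⊆B j∈T) λ { refl → j∉⁅p⁆ (x∈⁅x⁆ p) }
      ... | inj₂ (j∉T , j∈⁅p⁆) = contradiction (subst (_∈ T) (sym (x∈⁅y⁆⇒x≡y p j∈⁅p⁆)) p∈T) j∉T
      T≡⁅p⁆ : T ≡ ⁅ p ⁆
      T≡⁅p⁆ = ⊕≡𝟎⇒≡ (indep′ (T ⊕ ⁅ p ⁆) T-p⊆B′ (begin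
        sumOver f′ (T ⊕ ⁅ p ⁆)         ≡⟨ sumOver-⊕⁅⁆ f′ T p ⟩
        sumOver f′ T ⊕ f′ p           ≡⟨ cong₂ _⊕_ (trans (sumOver-f′ T) (cong eliminate sum≡𝟎)) eliminate-pivot ⟩
        eliminate 𝟎 ⊕ 𝟎               ≡⟨ trans (⊕-identityʳ _) eliminate-𝟎 ⟩
        𝟎                             ∎))
        where open ≡-Reasoning
      fp≡𝟎 : f p ≡ 𝟎
      fp≡𝟎 = trans (sym (sumOver-⁅⁆ f p)) (trans (cong (sumOver f) (sym T≡⁅p⁆)) sum≡𝟎)

    span : (∀ i → InSpan f′ B′ (f′ i)) → ∀ i → InSpan f (⁅ p ⁆ ⊕ B′) (f i)
    span span′ i with span′ i
    ... | T′ , T′⊆B′ , sum′≡ = T′ ⊕ c · ⁅ p ⁆ , ⊕-⊆ (λ j∈ → B′⊆B (T′⊆B′ j∈)) (λ j∈ → ⁅p⁆⊆B (∈-· c ⁅ p ⁆ j∈)) , sum≡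
      where
      w : V (suc m)
      w = sumOver f T′ ⊕ f i
      c : Bool
      c = head w
      w≡c·fp : w ≡ c · f p
      w≡c·fp = eliminate≡𝟎 w (begin
        eliminate (sumOver f T′ ⊕ f i)           ≡⟨ eliminate-⊕ (sumOver f T′) (f i) ⟩
        eliminate (sumOver f T′) ⊕ f′ i          ≡⟨ cong (_⊕ f′ i) (trans (sym (sumOver-f′ T′)) sum′≡) ⟩
        f′ i ⊕ f′ i                              ≡⟨ ⊕-self (f′ i) ⟩
        𝟎                                        ∎)
        where open ≡-Reasoning
      sum≡ : sumOver f (T′ ⊕ c · ⁅ p ⁆) ≡ f i
      sum≡ = begin
        sumOver f (T′ ⊕ c · ⁅ p ⁆)              ≡⟨ sumOver-⊕ f T′ (c · ⁅ p ⁆) ⟩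
        sumOver f T′ ⊕ sumOver f (c · ⁅ p ⁆)    ≡⟨ cong (sumOver f T′ ⊕_) (trans (sumOver-·⁅⁆ f c p) (sym w≡c·fp)) ⟩
        sumOver f T′ ⊕ (sumOver f T′ ⊕ f i)     ≡⟨ ⊕-assoc (sumOver f T′) _ _ ⟨
        sumOver f T′ ⊕ sumOver f T′ ⊕ f i       ≡⟨ cong (_⊕ f i) (⊕-self (sumOver f T′)) ⟩
        𝟎 ⊕ f i                                 ≡⟨ ⊕-identityˡ (f i) ⟩
        f i                                     ∎
        where open ≡-Reasoning

spanning⇒basis : ∀ {N} m (f : Fin N → V m) → Spanning f →
                 ∃ λ B → ∣ B ∣ ≡ m × LinIndep f B × (∀ i → InSpan f B (f i))
spanning⇒basis {N} zero f _ = ∅ , ∣⊥∣≡0 N , (λ T T⊆⊥ _ → ⊆-antisym T⊆⊥ ⊥⊆) , λ i → ∅ , ⊥⊆ , V0-unique _ _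
  where
  V0-unique : (u v : V 0) → u ≡ v
  V0-unique [] [] = refl
spanning⇒basis (suc m) f spanning with pivot f spanning
... | p , pivot-head with spanning⇒basis m f′ (f′-spanning spanning)
  where open Elimination f p pivot-head
...   | B′ , ∣B′∣≡m , indep′ , span′ =
  ⁅ p ⁆ ⊕ B′ , trans (∣B∣≡1+∣B′∣ indep′) (cong suc ∣B′∣≡m) , indep indep′ , span indep′ span′
  where open Elimination f p pivot-head

odd-∣⁅⁆∣ : ∀ {m} (i : Fin m) → Odd ∣ ⁅ i ⁆ ∣
odd-∣⁅⁆∣ i = subst Odd (sym (∣⁅x⁆∣≡1 i)) refl

∈aff : ∀ {m n} (f : Fin m → V n) {S} {i} → i ∈ S → InAff f S (f i)
∈aff f {i = i} i∈S = ⁅ i ⁆ , x∈p⇒⁅x⁆⊆p i∈S , odd-∣⁅⁆∣ i , sumOver-⁅⁆ f i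

record Basis {m n} (C : Fin m → V n) (B : Subset m) : Set where
  field
    independent : EvenZeroSumFree C B
    rep         : Fin m → Subset m
    rep-isBx    : ∀ x → IsBx C B x (rep x)

  rep⊆B : ∀ x → rep x ⊆ B
  rep⊆B x = proj₁ (rep-isBx x)

  rep-parity : ∀ x → parity ∣ rep x ∣ ≡ 1ℙ
  rep-parity x = odd⇒parity≡1ℙ ∣ rep x ∣ (proj₁ (proj₂ (rep-isBx x)))

  rep-sum : ∀ x → sumOver C (rep x) ≡ C x
  rep-sum x = proj₂ (proj₂ (rep-isBx x))

  isBx⇒≡rep : ∀ {x T} → IsBx C B x T → T ≡ rep x
  isBx⇒≡rep {x} {T} (T⊆B , odd , sum≡) =
    sumOver-injective independent T⊆B (rep⊆B x) (trans (odd⇒parity≡1ℙ ∣ T ∣ odd) (sym (rep-parity x))) (trans sum≡ (sym (rep-sum x)))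

  sumOver-sumOver-rep : ∀ T → sumOver C (sumOver rep T) ≡ sumOver C T
  sumOver-sumOver-rep T = trans (sumOver-sumOver C rep T) (sumOver-cong rep-sum T)

  sameAff : SameAff C B C ⊤
  sameAff v = mk⇔ (λ (T , _ , odd , sum≡) → T , ⊆⊤ , odd , sum≡)
    λ (T , _ , odd , sum≡) → sumOver rep T , sumOver-⊆ rep⊆B T ,
      parity≡1ℙ⇒odd ∣ sumOver rep T ∣ (trans (parity-∣sumOver∣ rep rep-parity T) (odd⇒parity≡1ℙ ∣ T ∣ odd)) ,
      trans (sumOver-sumOver-rep T) sum≡

  isBasis : IsBasis C ⊤ B
  isBasis = ⊆⊤ , EvenZeroSumFree⇒AffIndep C B independent , sameAff

IsBasis⇒Basis : ∀ {m n} {C : Fin m → V n} {B} → IsBasis C ⊤ B → Basis C B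
IsBasis⇒Basis {C = C} {B} (_ , indep , same) = record
  { independent = AffIndep⇒EvenZeroSumFree C B indep
  ; rep         = λ x → proj₁ (in-aff x)
  ; rep-isBx    = λ x → proj₂ (in-aff x)
  }
  where
  in-aff : ∀ x → InAff C B (C x)
  in-aff x = Equivalence.from (same (C x)) (∈aff C ∈⊤)

-- Writing each point in coordinates with respect to an affine basis of aff(C) reduces the
-- existence of a basis to the linear-algebra statement spanning⇒basis.
basis-of-dimension : ∀ {m n} d (C : Fin m → V n) → HasDim C ⊤ d → ∃ λ B → ∣ B ∣ ≡ suc d × Basis C B
basis-of-dimension {m} d C (g , g-indep , same) = from-coordinates (spanning⇒basis (suc d) S S-spanning)
  where
  g-free : EvenZeroSumFree g ⊤
  g-free = AffIndep⇒EvenZeroSumFree g ⊤ g-indep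

  coordinates : ∀ i → InAff g ⊤ (C i)
  coordinates i = Equivalence.from (same (C i)) (∈aff C ∈⊤)

  S : Fin m → Subset (suc d)
  S i = proj₁ (coordinates i)

  S-parity : ∀ i → parity ∣ S i ∣ ≡ 1ℙ
  S-parity i = odd⇒parity≡1ℙ ∣ S i ∣ (proj₁ (proj₂ (proj₂ (coordinates i))))

  sumOver-C : ∀ T → sumOver C T ≡ sumOver g (sumOver S T)
  sumOver-C T = trans (sumOver-cong (λ i → sym (proj₂ (proj₂ (proj₂ (coordinates i))))) T) (sym (sumOver-sumOver g S T))

  S-spanning : Spanning S
  S-spanning v = sumOver R v , trans (sumOver-sumOver S R v) (trans (sumOver-cong SR≡⁅⁆ v) (sumOver-singletons v))
    where
    R : Fin (suc d) → Subset m
    R k = proj₁ (Equivalence.to (same (g k)) (∈aff g ∈⊤))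
    SR≡⁅⁆ : ∀ k → sumOver S (R k) ≡ ⁅ k ⁆
    SR≡⁅⁆ k with Equivalence.to (same (g k)) (∈aff g ∈⊤)
    ... | (Rk , _ , odd , sum≡) = sumOver-injective g-free ⊆⊤ ⊆⊤
      (trans (parity-∣sumOver∣ S S-parity Rk) (trans (odd⇒parity≡1ℙ ∣ Rk ∣ odd) (sym (parity-∣⁅⁆∣ k))))
      (trans (sym (sumOver-C Rk)) (trans sum≡ (sym (sumOver-⁅⁆ g k))))

  from-coordinates : (∃ λ B → ∣ B ∣ ≡ suc d × LinIndep S B × (∀ i → InSpan S B (S i))) →
                     ∃ λ B → ∣ B ∣ ≡ suc d × Basis C B
  from-coordinates (B , ∣B∣ , S-indep , S-span) = B , ∣B∣ , record
    { independent = λ T T⊆B sum≡𝟎 even → S-indep T T⊆B (g-free (sumOver S T) ⊆⊤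
        (trans (sym (sumOver-C T)) sum≡𝟎) (trans (parity-∣sumOver∣ S S-parity T) even))
    ; rep         = λ i → proj₁ (S-span i)
    ; rep-isBx    = λ i → let (T , T⊆B , ST≡Si) = S-span i in
        T⊆B ,
        parity≡1ℙ⇒odd ∣ T ∣ (trans (sym (parity-∣sumOver∣ S S-parity T)) (trans (cong (parity ∘ ∣_∣) ST≡Si) (S-parity i))) ,
        trans (sumOver-C T) (trans (cong (sumOver g) ST≡Si) (proj₂ (proj₂ (proj₂ (coordinates i)))))
    }

-- Arithmetic of cardinalities inside an 8-element set. False bounds between numerals are refuted
-- by evaluation, through ≤⇒≤ᵇ.

odd≤8⇒5⊎7 : ∀ {s} → s ≤ 8 → Odd s → s ≢ 1 → s ≢ 3 → s ≡ 5 ⊎ s ≡ 7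
odd≤8⇒5⊎7 {1} _ _ s≢1 _ = contradiction refl s≢1
odd≤8⇒5⊎7 {3} _ _ _ s≢3 = contradiction refl s≢3
odd≤8⇒5⊎7 {5} _ _ _ _   = inj₁ refl
odd≤8⇒5⊎7 {7} _ _ _ _   = inj₂ refl
odd≤8⇒5⊎7 {suc (suc (suc (suc (suc (suc (suc (suc (suc _))))))))} s≤8 = ⊥-elim (≤⇒≤ᵇ s≤8)

pair-5-5⇒2⊎3 : ∀ {a b p u d} → a ≡ 5 → b ≡ 5 → p ≤ 5 → p + u ≡ a + b → u ≤ 8 → 2 * p + d ≡ a + b →
           d ≢ 0 → d ≢ 2 → p ≡ 2 ⊎ p ≡ 3
pair-5-5⇒2⊎3 {p = 0} refl refl _ refl u≤8 _ _ _ = ⊥-elim (≤⇒≤ᵇ u≤8)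
pair-5-5⇒2⊎3 {p = 1} refl refl _ refl u≤8 _ _ _ = ⊥-elim (≤⇒≤ᵇ u≤8)
pair-5-5⇒2⊎3 {p = 2} _    _    _ _    _   _ _ _ = inj₁ refl
pair-5-5⇒2⊎3 {p = 3} _    _    _ _    _   _ _ _ = inj₂ refl
pair-5-5⇒2⊎3 {p = 4} refl refl _ _ _ refl _ d≢2 = contradiction refl d≢2
pair-5-5⇒2⊎3 {p = 5} refl refl _ _ _ refl d≢0 _ = contradiction refl d≢0
pair-5-5⇒2⊎3 {p = suc (suc (suc (suc (suc (suc _)))))} _ _ p≤5 = ⊥-elim (≤⇒≤ᵇ p≤5)

pair-5-7⇒4 : ∀ {a b p u d} → a ≡ 5 → b ≡ 7 → p ≤ 5 → p + u ≡ a + b → u ≤ 8 → 2 * p + d ≡ a + b →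
           d ≢ 0 → d ≢ 2 → p ≡ 4
pair-5-7⇒4 {p = 0} refl refl _ refl u≤8 _ _ _ = ⊥-elim (≤⇒≤ᵇ u≤8)
pair-5-7⇒4 {p = 1} refl refl _ refl u≤8 _ _ _ = ⊥-elim (≤⇒≤ᵇ u≤8)
pair-5-7⇒4 {p = 2} refl refl _ refl u≤8 _ _ _ = ⊥-elim (≤⇒≤ᵇ u≤8)
pair-5-7⇒4 {p = 3} refl refl _ refl u≤8 _ _ _ = ⊥-elim (≤⇒≤ᵇ u≤8)
pair-5-7⇒4 {p = 4} _    _    _ _    _   _ _ _ = refl
pair-5-7⇒4 {p = 5} refl refl _ _ _ refl _ d≢2 = contradiction refl d≢2
pair-5-7⇒4 {p = suc (suc (suc (suc (suc (suc _)))))} _ _ p≤5 = ⊥-elim (≤⇒≤ᵇ p≤5)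

pair-7-7⇒⊥ : ∀ {a b p u d} → a ≡ 7 → b ≡ 7 → p ≤ 7 → p + u ≡ a + b → u ≤ 8 → 2 * p + d ≡ a + b →
         d ≢ 0 → d ≢ 2 → ⊥
pair-7-7⇒⊥ {p = 0} refl refl _ refl u≤8 _ _ _ = ≤⇒≤ᵇ u≤8
pair-7-7⇒⊥ {p = 1} refl refl _ refl u≤8 _ _ _ = ≤⇒≤ᵇ u≤8
pair-7-7⇒⊥ {p = 2} refl refl _ refl u≤8 _ _ _ = ≤⇒≤ᵇ u≤8
pair-7-7⇒⊥ {p = 3} refl refl _ refl u≤8 _ _ _ = ≤⇒≤ᵇ u≤8
pair-7-7⇒⊥ {p = 4} refl refl _ refl u≤8 _ _ _ = ≤⇒≤ᵇ u≤8
pair-7-7⇒⊥ {p = 5} refl refl _ refl u≤8 _ _ _ = ≤⇒≤ᵇ u≤8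
pair-7-7⇒⊥ {p = 6} refl refl _ _ _ refl _ d≢2 = d≢2 refl
pair-7-7⇒⊥ {p = 7} refl refl _ _ _ refl d≢0 _ = d≢0 refl
pair-7-7⇒⊥ {p = suc (suc (suc (suc (suc (suc (suc (suc _)))))))} _ _ p≤7 = ⊥-elim (≤⇒≤ᵇ p≤7)

triple-5-5-5-2-2⇒⊥ : ∀ {a b c p q r t u d} → a ≡ 5 → b ≡ 5 → c ≡ 5 → p ≡ 2 → q ≡ 2 → r ≡ 2 ⊎ r ≡ 3 →
  p + q + r + u ≡ a + b + c + t → u ≤ 8 → 2 * (p + q + r) + d ≡ a + b + c + 4 * t → d ≢ 1 → ⊥
triple-5-5-5-2-2⇒⊥ refl refl refl refl refl (inj₁ refl) refl u≤8 _ _ = ≤⇒≤ᵇ u≤8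
triple-5-5-5-2-2⇒⊥ {t = 0} refl refl refl refl refl (inj₂ refl) refl _ refl d≢1 = d≢1 refl
triple-5-5-5-2-2⇒⊥ {t = suc _} refl refl refl refl refl (inj₂ refl) refl u≤8 _ _ = ≤⇒≤ᵇ u≤8

triple-5-5-5-3-3-3⇒2 : ∀ {a b c p q r t u d} → a ≡ 5 → b ≡ 5 → c ≡ 5 → p ≡ 3 → q ≡ 3 → r ≡ 3 →
  p + q + r + u ≡ a + b + c + t → u ≤ 8 → 2 * (p + q + r) + d ≡ a + b + c + 4 * t → d ≢ 1 → t ≡ 2
triple-5-5-5-3-3-3⇒2 {t = 0} refl refl refl refl refl refl refl _ () _
triple-5-5-5-3-3-3⇒2 {t = 1} refl refl refl refl refl refl refl _ refl d≢1 = contradiction refl d≢1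
triple-5-5-5-3-3-3⇒2 {t = 2} _    _    _    _    _    _    _    _ _    _   = refl
triple-5-5-5-3-3-3⇒2 {t = suc (suc (suc _))} refl refl refl refl refl refl refl u≤8 _ _ = ⊥-elim (≤⇒≤ᵇ u≤8)

triple-5-5-7-2-4-4⇒⊥ : ∀ {a b c p q r t u d} → a ≡ 5 → b ≡ 5 → c ≡ 7 → p ≡ 2 → q ≡ 4 → r ≡ 4 →
  p + q + r + u ≡ a + b + c + t → u ≤ 8 → 2 * (p + q + r) + d ≡ a + b + c + 4 * t → d ≢ 1 → ⊥
triple-5-5-7-2-4-4⇒⊥ {t = 0} refl refl refl refl refl refl refl _ () _
triple-5-5-7-2-4-4⇒⊥ {t = 1} refl refl refl refl refl refl refl _ refl d≢1 = d≢1 refl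
triple-5-5-7-2-4-4⇒⊥ {t = suc (suc _)} refl refl refl refl refl refl refl u≤8 _ _ = ≤⇒≤ᵇ u≤8

quadruple-5-5-5-5⇒⊥ : ∀ {a b c e p₁ p₂ p₃ p₄ p₅ p₆ t₁ t₂ t₃ t₄ q u d} →
  a ≡ 5 → b ≡ 5 → c ≡ 5 → e ≡ 5 →
  p₁ ≡ 3 → p₂ ≡ 3 → p₃ ≡ 3 → p₄ ≡ 3 → p₅ ≡ 3 → p₆ ≡ 3 → t₁ ≡ 2 → t₂ ≡ 2 → t₃ ≡ 2 → t₄ ≡ 2 → q ≤ 5 →
  p₁ + p₂ + p₃ + p₄ + p₅ + p₆ + q + u ≡ a + b + c + e + (t₁ + t₂ + t₃ + t₄) → u ≤ 8 →
  2 * (p₁ + p₂ + p₃ + p₄ + p₅ + p₆) + 8 * q + d ≡ a + b + c + e + 4 * (t₁ + t₂ + t₃ + t₄) → d ≢ 0 → ⊥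
quadruple-5-5-5-5⇒⊥ {q = 0} refl refl refl refl refl refl refl refl refl refl refl refl refl refl _ refl u≤8 _ _ = ≤⇒≤ᵇ u≤8
quadruple-5-5-5-5⇒⊥ {q = 1} refl refl refl refl refl refl refl refl refl refl refl refl refl refl _ refl u≤8 _ _ = ≤⇒≤ᵇ u≤8
quadruple-5-5-5-5⇒⊥ {q = 2} refl refl refl refl refl refl refl refl refl refl refl refl refl refl _ _ _ refl d≢0 = d≢0 refl
quadruple-5-5-5-5⇒⊥ {q = 3} refl refl refl refl refl refl refl refl refl refl refl refl refl refl _ _ _ ()
quadruple-5-5-5-5⇒⊥ {q = 4} refl refl refl refl refl refl refl refl refl refl refl refl refl refl _ _ _ ()
quadruple-5-5-5-5⇒⊥ {q = 5} refl refl refl refl refl refl refl refl refl refl refl refl refl refl _ _ _ ()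
quadruple-5-5-5-5⇒⊥ {q = suc (suc (suc (suc (suc (suc _)))))} _ _ _ _ _ _ _ _ _ _ _ _ _ _ q≤5 = ⊥-elim (≤⇒≤ᵇ q≤5)

-- Dependent points of a basis of a cap

zero-sum-size≢2 : ∀ {m n} {C : Fin m → V n} → Injective _≡_ _≡_ C → ∀ K → sumOver C K ≡ 𝟎 → ∣ K ∣ ≢ 2
zero-sum-size≢2 {m} {C = C} injective K zero-sum ∣K∣≡2 = x∉p⊕⁅x⁆ a∈K (subst (_∈ K ⊕ ⁅ a ⁆) (injective Cb≡Ca) b∈)
  where
  a : Fin m
  a = proj₁ (∣p∣≡suc⇒nonempty K ∣K∣≡2)
  a∈K : a ∈ K
  a∈K = proj₂ (∣p∣≡suc⇒nonempty K ∣K∣≡2)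
  ∣K-a∣≡1 : ∣ K ⊕ ⁅ a ⁆ ∣ ≡ 1
  ∣K-a∣≡1 = suc-injective (trans (∣p⊕⁅x⁆∣-∈ a∈K) ∣K∣≡2)
  b : Fin m
  b = proj₁ (∣p∣≡suc⇒nonempty (K ⊕ ⁅ a ⁆) ∣K-a∣≡1)
  b∈ : b ∈ K ⊕ ⁅ a ⁆
  b∈ = proj₂ (∣p∣≡suc⇒nonempty (K ⊕ ⁅ a ⁆) ∣K-a∣≡1)
  K-a≡⁅b⁆ : K ⊕ ⁅ a ⁆ ≡ ⁅ b ⁆
  K-a≡⁅b⁆ = ⊕≡𝟎⇒≡ (∣p∣≡0⇒p≡∅ (K ⊕ ⁅ a ⁆ ⊕ ⁅ b ⁆) (suc-injective (trans (∣p⊕⁅x⁆∣-∈ b∈) ∣K-a∣≡1)))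
  Cb≡Ca : C b ≡ C a
  Cb≡Ca = begin
    C b                     ≡⟨ sumOver-⁅⁆ C b ⟨
    sumOver C ⁅ b ⁆         ≡⟨ cong (sumOver C) K-a≡⁅b⁆ ⟨
    sumOver C (K ⊕ ⁅ a ⁆)   ≡⟨ sumOver-⊕⁅⁆ C K a ⟩
    sumOver C K ⊕ C a       ≡⟨ trans (cong (_⊕ C a) zero-sum) (⊕-identityˡ (C a)) ⟩
    C a                     ∎
    where open ≡-Reasoning

module Dependents {m n} {C : Fin m → V n} (C-injective : Injective _≡_ _≡_ C) (cap : IsCap C ⊤)
                  {B : Subset m} (basis : Basis C B) where

  open Basis basis

  record DependentSet (J R : Subset m) (k : ℕ) : Set where
    field
      outside : ∀ {j} → j ∈ J → j ∉ B
      sum-rep : sumOver rep J ≡ R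
      size    : ∣ J ∣ ≡ k

  -- R ⊕ J is a zero-sum set of size ∣ R ∣ + k.
  no-relation-of-size-2-or-4 : ∀ {J R k} → DependentSet J R k → ∣ R ∣ + k ≢ 2 × ∣ R ∣ + k ≢ 4
  no-relation-of-size-2-or-4 {J} {R} {k} dep =
    (λ ≡2 → zero-sum-size≢2 C-injective (R ⊕ J) zero-sum (trans size ≡2)) ,
    (λ ≡4 → cap (R ⊕ J) ⊆⊤ (trans size ≡4) zero-sum)
    where
    open DependentSet dep renaming (size to ∣J∣≡k)
    zero-sum : sumOver C (R ⊕ J) ≡ 𝟎
    zero-sum = begin
      sumOver C (R ⊕ J)                 ≡⟨ sumOver-⊕ C R J ⟩
      sumOver C R ⊕ sumOver C J         ≡⟨ cong (λ R → sumOver C R ⊕ sumOver C J) sum-rep ⟨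
      sumOver C (sumOver rep J) ⊕ sumOver C J ≡⟨ cong (_⊕ sumOver C J) (sumOver-sumOver-rep J) ⟩
      sumOver C J ⊕ sumOver C J         ≡⟨ ⊕-self (sumOver C J) ⟩
      𝟎                                 ∎
      where open ≡-Reasoning
    size : ∣ R ⊕ J ∣ ≡ ∣ R ∣ + k
    size = trans (∣⊕∣-disjoint R J λ j∈R j∈J → outside j∈J (sumOver-⊆ rep⊆B J (subst (_ ∈_) (sym sum-rep) j∈R)))
                 (cong (∣ R ∣ +_) ∣J∣≡k)

  single : ∀ {x} → x ∉ B → DependentSet ⁅ x ⁆ (rep x) 1
  single {x} x∉B = record
    { outside = λ j∈ → subst (_∉ B) (sym (x∈⁅y⁆⇒x≡y x j∈)) x∉B
    ; sum-rep = sumOver-⁅⁆ rep x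
    ; size    = ∣⁅x⁆∣≡1 x
    }

  add : ∀ {J R k a} → DependentSet J R k → a ∉ B → a ∉ J → DependentSet (J ⊕ ⁅ a ⁆) (R ⊕ rep a) (suc k)
  add {J} {R} {k} {a} dep a∉B a∉J = record
    { outside = outside′
    ; sum-rep = trans (sumOver-⊕⁅⁆ rep J a) (cong (_⊕ rep a) sum-rep)
    ; size    = trans (∣p⊕⁅x⁆∣-∉ a∉J) (cong suc size)
    }
    where
    open DependentSet dep
    outside′ : ∀ {j} → j ∈ J ⊕ ⁅ a ⁆ → j ∉ B
    outside′ j∈ with ∈⊕⁻ J ⁅ a ⁆ j∈
    ... | inj₁ (j∈J , _)   = outside j∈J
    ... | inj₂ (_ , j∈⁅a⁆) = subst (_∉ B) (sym (x∈⁅y⁆⇒x≡y a j∈⁅a⁆)) a∉B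

  ∣rep∣≢1,3 : ∀ {x} → x ∉ B → ∣ rep x ∣ ≢ 1 × ∣ rep x ∣ ≢ 3
  ∣rep∣≢1,3 {x} x∉B = (λ ≡1 → proj₁ excluded (cong (_+ 1) ≡1)) , (λ ≡3 → proj₂ excluded (cong (_+ 1) ≡3))
    where
    excluded : ∣ rep x ∣ + 1 ≢ 2 × ∣ rep x ∣ + 1 ≢ 4
    excluded = no-relation-of-size-2-or-4 (single x∉B)

  ∣rep⊕rep∣≢0,2 : ∀ {x y} → x ∉ B → y ∉ B → x ≢ y → ∣ rep x ⊕ rep y ∣ ≢ 0 × ∣ rep x ⊕ rep y ∣ ≢ 2
  ∣rep⊕rep∣≢0,2 {x} {y} x∉B y∉B x≢y = (λ ≡0 → proj₁ excluded (cong (_+ 2) ≡0)) , (λ ≡2 → proj₂ excluded (cong (_+ 2) ≡2))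
    where
    excluded : ∣ rep x ⊕ rep y ∣ + 2 ≢ 2 × ∣ rep x ⊕ rep y ∣ + 2 ≢ 4
    excluded = no-relation-of-size-2-or-4 (add (single x∉B) y∉B (x≢y⇒x∉⁅y⁆ (x≢y ∘ sym)))

  ∣rep⊕rep⊕rep∣≢1 : ∀ {x y z} → x ∉ B → y ∉ B → z ∉ B → x ≢ y → x ≢ z → y ≢ z →
                    ∣ rep x ⊕ rep y ⊕ rep z ∣ ≢ 1
  ∣rep⊕rep⊕rep∣≢1 {x} {y} {z} x∉B y∉B z∉B x≢y x≢z y≢z ≡1 =
    proj₂ (no-relation-of-size-2-or-4 xyz) (cong (_+ 3) ≡1)
    where
    xyz : DependentSet (⁅ x ⁆ ⊕ ⁅ y ⁆ ⊕ ⁅ z ⁆) (rep x ⊕ rep y ⊕ rep z) 3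
    xyz = add (add (single x∉B) y∉B (x≢y⇒x∉⁅y⁆ (x≢y ∘ sym))) z∉B
              (∉⊕⁅⁆ (x≢y⇒x∉⁅y⁆ (x≢z ∘ sym)) (y≢z ∘ sym))

  ∣rep⊕rep⊕rep⊕rep∣≢0 : ∀ {x y z w} → x ∉ B → y ∉ B → z ∉ B → w ∉ B →
                        x ≢ y → x ≢ z → x ≢ w → y ≢ z → y ≢ w → z ≢ w →
                        ∣ rep x ⊕ rep y ⊕ rep z ⊕ rep w ∣ ≢ 0
  ∣rep⊕rep⊕rep⊕rep∣≢0 {x} {y} {z} {w} x∉B y∉B z∉B w∉B x≢y x≢z x≢w y≢z y≢w z≢w ≡0 =
    proj₂ (no-relation-of-size-2-or-4 xyzw) (cong (_+ 4) ≡0)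
    where
    xyzw : DependentSet (⁅ x ⁆ ⊕ ⁅ y ⁆ ⊕ ⁅ z ⁆ ⊕ ⁅ w ⁆) (rep x ⊕ rep y ⊕ rep z ⊕ rep w) 4
    xyzw = add (add (add (single x∉B) y∉B (x≢y⇒x∉⁅y⁆ (x≢y ∘ sym))) z∉B
                    (∉⊕⁅⁆ (x≢y⇒x∉⁅y⁆ (x≢z ∘ sym)) (y≢z ∘ sym))) w∉B
               (∉⊕⁅⁆ (∉⊕⁅⁆ (x≢y⇒x∉⁅y⁆ (x≢w ∘ sym)) (y≢w ∘ sym)) (z≢w ∘ sym))

  module EightPointBasis (∣B∣≡8 : ∣ B ∣ ≡ 8) where

    private
      ≤8 : ∀ {X : Subset m} → X ⊆ B → ∣ X ∣ ≤ 8
      ≤8 X⊆B = ≤-trans (p⊆q⇒∣p∣≤∣q∣ X⊆B) (≤-reflexive ∣B∣≡8)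

      ∣∩∣≤ : ∀ {k} (X Y : Subset m) → ∣ X ∣ ≡ k → ∣ X ∩ Y ∣ ≤ k
      ∣∩∣≤ X Y ∣X∣≡k = ≤-trans (∣p∩q∣≤∣p∣ X Y) (≤-reflexive ∣X∣≡k)

      ∪⊆B : ∀ x y → rep x ∪ rep y ⊆ B
      ∪⊆B x y = ∪-⊆ (rep⊆B x) (rep⊆B y)

    ∣rep∣≡5⊎7 : ∀ {x} → x ∉ B → ∣ rep x ∣ ≡ 5 ⊎ ∣ rep x ∣ ≡ 7
    ∣rep∣≡5⊎7 {x} x∉B =
      odd≤8⇒5⊎7 (≤8 (rep⊆B x)) (proj₁ (proj₂ (rep-isBx x))) (proj₁ (∣rep∣≢1,3 x∉B)) (proj₂ (∣rep∣≢1,3 x∉B))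

    ¬7-7 : ∀ {x y} → x ∉ B → y ∉ B → x ≢ y → ∣ rep x ∣ ≡ 7 → ∣ rep y ∣ ≢ 7
    ¬7-7 {x} {y} x∉B y∉B x≢y ∣x∣≡7 ∣y∣≡7 =
      pair-7-7⇒⊥ ∣x∣≡7 ∣y∣≡7 (∣∩∣≤ (rep x) (rep y) ∣x∣≡7) (∣∪∣-incl-excl₂ (rep x) (rep y)) (≤8 (∪⊆B x y))
        (∣⊕∣-incl-excl₂ (rep x) (rep y)) (proj₁ (∣rep⊕rep∣≢0,2 x∉B y∉B x≢y)) (proj₂ (∣rep⊕rep∣≢0,2 x∉B y∉B x≢y))

    ∣rep∩rep∣≡4 : ∀ {x y} → x ∉ B → y ∉ B → x ≢ y → ∣ rep x ∣ ≡ 5 → ∣ rep y ∣ ≡ 7 → ∣ rep x ∩ rep y ∣ ≡ 4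
    ∣rep∩rep∣≡4 {x} {y} x∉B y∉B x≢y ∣x∣≡5 ∣y∣≡7 =
      pair-5-7⇒4 ∣x∣≡5 ∣y∣≡7 (∣∩∣≤ (rep x) (rep y) ∣x∣≡5) (∣∪∣-incl-excl₂ (rep x) (rep y)) (≤8 (∪⊆B x y))
        (∣⊕∣-incl-excl₂ (rep x) (rep y)) (proj₁ (∣rep⊕rep∣≢0,2 x∉B y∉B x≢y)) (proj₂ (∣rep⊕rep∣≢0,2 x∉B y∉B x≢y))

    ∣rep∩rep∣≡2⊎3 : ∀ {x y} → x ∉ B → y ∉ B → x ≢ y → ∣ rep x ∣ ≡ 5 → ∣ rep y ∣ ≡ 5 →
                    ∣ rep x ∩ rep y ∣ ≡ 2 ⊎ ∣ rep x ∩ rep y ∣ ≡ 3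
    ∣rep∩rep∣≡2⊎3 {x} {y} x∉B y∉B x≢y ∣x∣≡5 ∣y∣≡5 =
      pair-5-5⇒2⊎3 ∣x∣≡5 ∣y∣≡5 (∣∩∣≤ (rep x) (rep y) ∣x∣≡5) (∣∪∣-incl-excl₂ (rep x) (rep y)) (≤8 (∪⊆B x y))
        (∣⊕∣-incl-excl₂ (rep x) (rep y)) (proj₁ (∣rep⊕rep∣≢0,2 x∉B y∉B x≢y)) (proj₂ (∣rep⊕rep∣≢0,2 x∉B y∉B x≢y))

    ¬5-5-7-with-2-4-4 : ∀ {x y z} → x ∉ B → y ∉ B → z ∉ B → x ≢ y → x ≢ z → y ≢ z →
      ∣ rep x ∣ ≡ 5 → ∣ rep y ∣ ≡ 5 → ∣ rep z ∣ ≡ 7 →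
      ∣ rep x ∩ rep y ∣ ≡ 2 → ∣ rep x ∩ rep z ∣ ≡ 4 → ∣ rep y ∩ rep z ∣ ≡ 4 → ⊥
    ¬5-5-7-with-2-4-4 {x} {y} {z} x∉B y∉B z∉B x≢y x≢z y≢z ∣x∣ ∣y∣ ∣z∣ xy xz yz =
      triple-5-5-7-2-4-4⇒⊥ ∣x∣ ∣y∣ ∣z∣ xy xz yz (∣∪∣-incl-excl₃ (rep x) (rep y) (rep z))
        (≤8 (∪-⊆ (rep⊆B x) (∪⊆B y z))) (∣⊕∣-incl-excl₃ (rep x) (rep y) (rep z))
        (∣rep⊕rep⊕rep∣≢1 x∉B y∉B z∉B x≢y x≢z y≢z)

    ¬5-5-5-with-2-2 : ∀ {x y z} → x ∉ B → y ∉ B → z ∉ B → x ≢ y → x ≢ z → y ≢ z →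
      ∣ rep x ∣ ≡ 5 → ∣ rep y ∣ ≡ 5 → ∣ rep z ∣ ≡ 5 → ∣ rep x ∩ rep y ∣ ≡ 2 → ∣ rep x ∩ rep z ∣ ≡ 2 → ⊥
    ¬5-5-5-with-2-2 {x} {y} {z} x∉B y∉B z∉B x≢y x≢z y≢z ∣x∣ ∣y∣ ∣z∣ xy xz =
      triple-5-5-5-2-2⇒⊥ ∣x∣ ∣y∣ ∣z∣ xy xz (∣rep∩rep∣≡2⊎3 y∉B z∉B y≢z ∣y∣ ∣z∣)
        (∣∪∣-incl-excl₃ (rep x) (rep y) (rep z)) (≤8 (∪-⊆ (rep⊆B x) (∪⊆B y z)))
        (∣⊕∣-incl-excl₃ (rep x) (rep y) (rep z)) (∣rep⊕rep⊕rep∣≢1 x∉B y∉B z∉B x≢y x≢z y≢z)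

    ∣rep∩rep∩rep∣≡2 : ∀ {x y z} → x ∉ B → y ∉ B → z ∉ B → x ≢ y → x ≢ z → y ≢ z →
      ∣ rep x ∣ ≡ 5 → ∣ rep y ∣ ≡ 5 → ∣ rep z ∣ ≡ 5 →
      ∣ rep x ∩ rep y ∣ ≡ 3 → ∣ rep x ∩ rep z ∣ ≡ 3 → ∣ rep y ∩ rep z ∣ ≡ 3 → ∣ rep x ∩ rep y ∩ rep z ∣ ≡ 2
    ∣rep∩rep∩rep∣≡2 {x} {y} {z} x∉B y∉B z∉B x≢y x≢z y≢z ∣x∣ ∣y∣ ∣z∣ xy xz yz =
      triple-5-5-5-3-3-3⇒2 ∣x∣ ∣y∣ ∣z∣ xy xz yz (∣∪∣-incl-excl₃ (rep x) (rep y) (rep z))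
        (≤8 (∪-⊆ (rep⊆B x) (∪⊆B y z))) (∣⊕∣-incl-excl₃ (rep x) (rep y) (rep z))
        (∣rep⊕rep⊕rep∣≢1 x∉B y∉B z∉B x≢y x≢z y≢z)

    ¬5-5-5-5-with-3s : ∀ {x y z w} → x ∉ B → y ∉ B → z ∉ B → w ∉ B →
      x ≢ y → x ≢ z → x ≢ w → y ≢ z → y ≢ w → z ≢ w →
      ∣ rep x ∣ ≡ 5 → ∣ rep y ∣ ≡ 5 → ∣ rep z ∣ ≡ 5 → ∣ rep w ∣ ≡ 5 →
      ∣ rep x ∩ rep y ∣ ≡ 3 → ∣ rep x ∩ rep z ∣ ≡ 3 → ∣ rep x ∩ rep w ∣ ≡ 3 →
      ∣ rep y ∩ rep z ∣ ≡ 3 → ∣ rep y ∩ rep w ∣ ≡ 3 → ∣ rep z ∩ rep w ∣ ≡ 3 → ⊥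
    ¬5-5-5-5-with-3s {x} {y} {z} {w} x∉B y∉B z∉B w∉B x≢y x≢z x≢w y≢z y≢w z≢w ∣x∣ ∣y∣ ∣z∣ ∣w∣ xy xz xw yz yw zw =
      quadruple-5-5-5-5⇒⊥ ∣x∣ ∣y∣ ∣z∣ ∣w∣ xy xz xw yz yw zw
        (∣rep∩rep∩rep∣≡2 x∉B y∉B z∉B x≢y x≢z y≢z ∣x∣ ∣y∣ ∣z∣ xy xz yz)
        (∣rep∩rep∩rep∣≡2 x∉B y∉B w∉B x≢y x≢w y≢w ∣x∣ ∣y∣ ∣w∣ xy xw yw)
        (∣rep∩rep∩rep∣≡2 x∉B z∉B w∉B x≢z x≢w z≢w ∣x∣ ∣z∣ ∣w∣ xz xw zw)
        (∣rep∩rep∩rep∣≡2 y∉B z∉B w∉B y≢z y≢w z≢w ∣y∣ ∣z∣ ∣w∣ yz yw zw)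
        (∣∩∣≤ (rep x) (rep y ∩ rep z ∩ rep w) ∣x∣)
        (∣∪∣-incl-excl₄ (rep x) (rep y) (rep z) (rep w))
        (≤8 (∪-⊆ (rep⊆B x) (∪-⊆ (rep⊆B y) (∪⊆B z w))))
        (∣⊕∣-incl-excl₄ (rep x) (rep y) (rep z) (rep w))
        (∣rep⊕rep⊕rep⊕rep∣≢0 x∉B y∉B z∉B w∉B x≢y x≢z x≢w y≢z y≢w z≢w)

toggle : ∀ {m} → Fin m → Subset m → Subset m → Subset m
toggle a X Y = does (a ∈? Y) · X ⊕ Y

∉-toggle : ∀ {m} {a : Fin m} {X} Y → a ∈ X → a ∉ toggle a X Y
∉-toggle {a = a} {X} Y a∈X with a ∈? Y
... | yes a∈Y = ∈∈⇒∉⊕ a∈X a∈Y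
... | no  a∉Y = λ a∈ → a∉Y (subst (a ∈_) (⊕-identityˡ Y) a∈)

toggle-of-∈ : ∀ {m} {a : Fin m} {X} Y → a ∈ Y → toggle a X Y ≡ X ⊕ Y
toggle-of-∈ {a = a} Y a∈Y with a ∈? Y
... | yes _   = refl
... | no  a∉Y = contradiction a∈Y a∉Y

toggle-of-∉ : ∀ {m} {a : Fin m} {X} Y → a ∉ Y → toggle a X Y ≡ Y
toggle-of-∉ {a = a} Y a∉Y with a ∈? Y
... | yes a∈Y = contradiction a∈Y a∉Y
... | no  _   = ⊕-identityˡ Y

toggle-⊆ : ∀ {m} (a : Fin m) {X Y S} → X ⊆ S → Y ⊆ S → toggle a X Y ⊆ S
toggle-⊆ a {X} {Y} X⊆S Y⊆S = ⊕-⊆ (λ j∈ → X⊆S (∈-· (does (a ∈? Y)) X j∈)) Y⊆S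

-- Exchanging b ∈ B_y for y: as K = B_y ⊕ {y} sums to 0, adding K to every B_i containing b gives the
-- representations with respect to B′ = B - b + y.
module Exchange {m n} {C : Fin m → V n} {B : Subset m} (basis : Basis C B)
                {y b : Fin m} (y∉B : y ∉ B) (b∈By : b ∈ Basis.rep basis y) where

  open Basis basis

  K : Subset m
  K = rep y ⊕ ⁅ y ⁆

  B′ : Subset m
  B′ = B ⊕ ⁅ b ⁆ ⊕ ⁅ y ⁆

  rep′ : Fin m → Subset m
  rep′ i = toggle b K (rep i)

  b∈B : b ∈ B
  b∈B = rep⊆B y b∈By

  b≢y : b ≢ y
  b≢y refl = y∉B b∈B

  ∉⁅y⁆ : ∀ {j} → j ∈ B → j ∉ ⁅ y ⁆
  ∉⁅y⁆ j∈B j∈⁅y⁆ = y∉B (subst (_∈ B) (x∈⁅y⁆⇒x≡y y j∈⁅y⁆) j∈B)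

  b∈K : b ∈ K
  b∈K = ∈⊕⁺ˡ b∈By (∉⁅y⁆ b∈B)

  y∈K : y ∈ K
  y∈K = ∈⊕⁺ʳ (y∉B ∘ rep⊆B y) (x∈⁅x⁆ y)

  K⊆B∪⁅y⁆ : K ⊆ B ∪ ⁅ y ⁆
  K⊆B∪⁅y⁆ = ⊕-⊆ (λ j∈ → x∈p∪q⁺ (inj₁ (rep⊆B y j∈))) (λ j∈ → x∈p∪q⁺ (inj₂ j∈))

  toggle-K-sum : ∀ a Y → sumOver C (toggle a K Y) ≡ sumOver C Y
  toggle-K-sum a Y = trans (sumOver-⊕ C (c · K) Y) (trans (cong (_⊕ sumOver C Y) (sum c)) (⊕-identityˡ _))
    where
    c : Bool
    c = does (a ∈? Y)
    sum : ∀ c → sumOver C (c · K) ≡ 𝟎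
    sum true  = trans (sumOver-⊕⁅⁆ C (rep y) y) (trans (cong (_⊕ C y) (rep-sum y)) (⊕-self (C y)))
    sum false = sumOver-∅ C

  toggle-K-parity : ∀ a Y → parity ∣ toggle a K Y ∣ ≡ parity ∣ Y ∣
  toggle-K-parity a Y = trans (parity-∣⊕∣ (c · K) Y) (cong (ℙ._+ parity ∣ Y ∣) (even c))
    where
    c : Bool
    c = does (a ∈? Y)
    even : ∀ c → parity ∣ c · K ∣ ≡ 0ℙ
    even true  = trans (parity-∣⊕⁅⁆∣ (rep y) y) (cong (ℙ._+ 1ℙ) (rep-parity y))
    even false = cong parity (∣⊥∣≡0 m)

  y∉B⊕⁅b⁆ : y ∉ B ⊕ ⁅ b ⁆
  y∉B⊕⁅b⁆ y∈ with ∈⊕⁻ B ⁅ b ⁆ y∈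
  ... | inj₁ (y∈B , _)   = y∉B y∈B
  ... | inj₂ (_ , y∈⁅b⁆) = b≢y (sym (x∈⁅y⁆⇒x≡y b y∈⁅b⁆))

  ∈B′ : ∀ {j} → j ∈ B → j ≢ b → j ∈ B′
  ∈B′ j∈B j≢b = ∈⊕⁺ˡ (∈⊕⁺ˡ j∈B (x≢y⇒x∉⁅y⁆ j≢b)) (∉⁅y⁆ j∈B)

  y∈B′ : y ∈ B′
  y∈B′ = ∈⊕⁺ʳ y∉B⊕⁅b⁆ (x∈⁅x⁆ y)

  b∉B′ : b ∉ B′
  b∉B′ b∈ with ∈⊕⁻ (B ⊕ ⁅ b ⁆) ⁅ y ⁆ b∈
  ... | inj₁ (b∈B⊕⁅b⁆ , _) = ∈∈⇒∉⊕ b∈B (x∈⁅x⁆ b) b∈B⊕⁅b⁆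
  ... | inj₂ (_ , b∈⁅y⁆)   = b≢y (x∈⁅y⁆⇒x≡y y b∈⁅y⁆)

  B′⊆B∪⁅y⁆ : B′ ⊆ B ∪ ⁅ y ⁆
  B′⊆B∪⁅y⁆ j∈ with ∈⊕⁻ (B ⊕ ⁅ b ⁆) ⁅ y ⁆ j∈
  ... | inj₂ (_ , j∈⁅y⁆) = x∈p∪q⁺ (inj₂ j∈⁅y⁆)
  ... | inj₁ (j∈ , _) with ∈⊕⁻ B ⁅ b ⁆ j∈
  ...   | inj₁ (j∈B , _)   = x∈p∪q⁺ (inj₁ j∈B)
  ...   | inj₂ (_ , j∈⁅b⁆) = x∈p∪q⁺ (inj₁ (subst (_∈ B) (sym (x∈⁅y⁆⇒x≡y b j∈⁅b⁆)) b∈B))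

  ⊆B′ : ∀ {X} → X ⊆ B ∪ ⁅ y ⁆ → b ∉ X → X ⊆ B′
  ⊆B′ {X} X⊆ b∉X {j} j∈X with x∈p∪q⁻ B ⁅ y ⁆ (X⊆ j∈X)
  ... | inj₁ j∈B   = ∈B′ j∈B λ { refl → b∉X j∈X }
  ... | inj₂ j∈⁅y⁆ = subst (_∈ B′) (sym (x∈⁅y⁆⇒x≡y y j∈⁅y⁆)) y∈B′

  ⊆B : ∀ {X} → X ⊆ B ∪ ⁅ y ⁆ → y ∉ X → X ⊆ B
  ⊆B {X} X⊆ y∉X {j} j∈X with x∈p∪q⁻ B ⁅ y ⁆ (X⊆ j∈X)
  ... | inj₁ j∈B   = j∈B
  ... | inj₂ j∈⁅y⁆ = contradiction (subst (_∈ X) (x∈⁅y⁆⇒x≡y y j∈⁅y⁆) j∈X) y∉X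

  ∣B′∣≡∣B∣ : ∣ B′ ∣ ≡ ∣ B ∣
  ∣B′∣≡∣B∣ = trans (∣p⊕⁅x⁆∣-∉ y∉B⊕⁅b⁆) (∣p⊕⁅x⁆∣-∈ b∈B)

  basis′ : Basis C B′
  basis′ = record
    { independent = independent′
    ; rep         = rep′
    ; rep-isBx    = λ i →
        ⊆B′ (toggle-⊆ b K⊆B∪⁅y⁆ (λ j∈ → x∈p∪q⁺ (inj₁ (rep⊆B i j∈)))) (∉-toggle (rep i) b∈K) ,
        parity≡1ℙ⇒odd ∣ rep′ i ∣ (trans (toggle-K-parity b (rep i)) (rep-parity i)) ,
        trans (toggle-K-sum b (rep i)) (rep-sum i)
    }
    where
    independent′ : EvenZeroSumFree C B′
    independent′ T T⊆B′ zero-sum even = T≡∅ (y ∈? T)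
      where
      -- toggling K by the membership of y moves T into B, where it is forced to vanish
      T″≡∅ : toggle y K T ≡ ∅
      T″≡∅ = independent (toggle y K T) (⊆B (toggle-⊆ y K⊆B∪⁅y⁆ (λ j∈ → B′⊆B∪⁅y⁆ (T⊆B′ j∈))) (∉-toggle T y∈K))
               (trans (toggle-K-sum y T) zero-sum) (trans (toggle-K-parity y T) even)
      T≡∅ : Dec (y ∈ T) → T ≡ ∅
      T≡∅ (yes y∈T) = ⊥-elim (b∉B′ (T⊆B′ (subst (b ∈_) (⊕≡𝟎⇒≡ (trans (sym (toggle-of-∈ T y∈T)) T″≡∅)) b∈K)))
      T≡∅ (no  y∉T) = trans (sym (toggle-of-∉ T y∉T)) T″≡∅

  rep′-∈ : ∀ {i} → b ∈ rep i → rep′ i ≡ K ⊕ rep i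
  rep′-∈ = toggle-of-∈ _

  rep′-∉ : ∀ {i} → b ∉ rep i → rep′ i ≡ rep i
  rep′-∉ = toggle-of-∉ _

  ∣K⊕X∣ : ∀ {X} → X ⊆ B → ∣ K ⊕ X ∣ ≡ suc ∣ rep y ⊕ X ∣
  ∣K⊕X∣ {X} X⊆B = begin
    ∣ rep y ⊕ ⁅ y ⁆ ⊕ X ∣      ≡⟨ cong ∣_∣ (trans (⊕-assoc (rep y) ⁅ y ⁆ X) (trans (cong (rep y ⊕_) (⊕-comm ⁅ y ⁆ X)) (sym (⊕-assoc (rep y) X ⁅ y ⁆)))) ⟩
    ∣ rep y ⊕ X ⊕ ⁅ y ⁆ ∣      ≡⟨ ∣p⊕⁅x⁆∣-∉ (y∉B ∘ ⊕-⊆ (rep⊆B y) X⊆B) ⟩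
    suc ∣ rep y ⊕ X ∣          ∎
    where open ≡-Reasoning

  dependent′ : ∀ {j} → j ∉ B′ → j ≡ b ⊎ j ∉ B × j ≢ y
  dependent′ {j} j∉B′ with j ≟ b
  ... | yes j≡b = inj₁ j≡b
  ... | no  j≢b = inj₂ ((λ j∈B → j∉B′ (∈B′ j∈B j≢b)) , λ { refl → j∉B′ y∈B′ })

private
  0F 1F 2F 3F : Fin 4
  0F = zero
  1F = suc zero
  2F = suc (suc zero)
  3F = suc (suc (suc zero))

module _ (s : Fin 4 → Fin 4 → ℕ) (s-sym : ∀ i j → s i j ≡ s j i)
         (apart : ∀ i j k → i ≢ j → i ≢ k → j ≢ k → s i j ≡ 2 → s i k ≢ 2) where

  -- The edges of K₄ labelled 2 share no vertex, so they form a matching: one or two edges unless none.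
  count2-matching : (∀ i j → i ≢ j → s i j ≡ 2 ⊎ s i j ≡ 3) →
    ¬ (s 0F 1F ≡ 3 × s 0F 2F ≡ 3 × s 0F 3F ≡ 3 × s 1F 2F ≡ 3 × s 1F 3F ≡ 3 × s 2F 3F ≡ 3) →
    count2 s ≡ 1 ⊎ count2 s ≡ 2
  count2-matching 2⊎3 not-all-3 =
    labels (2⊎3 0F 1F (λ ())) (2⊎3 0F 2F (λ ())) (2⊎3 0F 3F (λ ())) (2⊎3 1F 2F (λ ())) (2⊎3 1F 3F (λ ())) (2⊎3 2F 3F (λ ()))
    where
    flip : ∀ {i j} → s i j ≡ 2 → s j i ≡ 2
    flip {i} {j} = trans (s-sym j i)
    labels : s 0F 1F ≡ 2 ⊎ s 0F 1F ≡ 3 → s 0F 2F ≡ 2 ⊎ s 0F 2F ≡ 3 → s 0F 3F ≡ 2 ⊎ s 0F 3F ≡ 3 →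
             s 1F 2F ≡ 2 ⊎ s 1F 2F ≡ 3 → s 1F 3F ≡ 2 ⊎ s 1F 3F ≡ 3 → s 2F 3F ≡ 2 ⊎ s 2F 3F ≡ 3 →
             count2 s ≡ 1 ⊎ count2 s ≡ 2
    labels (inj₁ a) (inj₂ b) (inj₂ c) (inj₂ d) (inj₂ e) (inj₂ f) rewrite a | b | c | d | e | f = inj₁ refl
    labels (inj₂ a) (inj₁ b) (inj₂ c) (inj₂ d) (inj₂ e) (inj₂ f) rewrite a | b | c | d | e | f = inj₁ refl
    labels (inj₂ a) (inj₂ b) (inj₁ c) (inj₂ d) (inj₂ e) (inj₂ f) rewrite a | b | c | d | e | f = inj₁ refl
    labels (inj₂ a) (inj₂ b) (inj₂ c) (inj₁ d) (inj₂ e) (inj₂ f) rewrite a | b | c | d | e | f = inj₁ refl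
    labels (inj₂ a) (inj₂ b) (inj₂ c) (inj₂ d) (inj₁ e) (inj₂ f) rewrite a | b | c | d | e | f = inj₁ refl
    labels (inj₂ a) (inj₂ b) (inj₂ c) (inj₂ d) (inj₂ e) (inj₁ f) rewrite a | b | c | d | e | f = inj₁ refl
    labels (inj₁ a) (inj₂ b) (inj₂ c) (inj₂ d) (inj₂ e) (inj₁ f) rewrite a | b | c | d | e | f = inj₂ refl
    labels (inj₂ a) (inj₁ b) (inj₂ c) (inj₂ d) (inj₁ e) (inj₂ f) rewrite a | b | c | d | e | f = inj₂ refl
    labels (inj₂ a) (inj₂ b) (inj₁ c) (inj₁ d) (inj₂ e) (inj₂ f) rewrite a | b | c | d | e | f = inj₂ refl
    labels (inj₂ a) (inj₂ b) (inj₂ c) (inj₂ d) (inj₂ e) (inj₂ f) = ⊥-elim (not-all-3 (a , b , c , d , e , f))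
    labels (inj₁ a) (inj₁ b) _ _ _ _ = ⊥-elim (apart 0F 1F 2F (λ ()) (λ ()) (λ ()) a b)
    labels (inj₁ a) _ (inj₁ c) _ _ _ = ⊥-elim (apart 0F 1F 3F (λ ()) (λ ()) (λ ()) a c)
    labels (inj₁ a) _ _ (inj₁ d) _ _ = ⊥-elim (apart 1F 0F 2F (λ ()) (λ ()) (λ ()) (flip a) d)
    labels (inj₁ a) _ _ _ (inj₁ e) _ = ⊥-elim (apart 1F 0F 3F (λ ()) (λ ()) (λ ()) (flip a) e)
    labels _ (inj₁ b) (inj₁ c) _ _ _ = ⊥-elim (apart 0F 2F 3F (λ ()) (λ ()) (λ ()) b c)
    labels _ (inj₁ b) _ (inj₁ d) _ _ = ⊥-elim (apart 2F 0F 1F (λ ()) (λ ()) (λ ()) (flip b) (flip d))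
    labels _ (inj₁ b) _ _ _ (inj₁ f) = ⊥-elim (apart 2F 0F 3F (λ ()) (λ ()) (λ ()) (flip b) f)
    labels _ _ (inj₁ c) _ (inj₁ e) _ = ⊥-elim (apart 3F 0F 1F (λ ()) (λ ()) (λ ()) (flip c) (flip e))
    labels _ _ (inj₁ c) _ _ (inj₁ f) = ⊥-elim (apart 3F 0F 2F (λ ()) (λ ()) (λ ()) (flip c) (flip f))
    labels _ _ _ (inj₁ d) (inj₁ e) _ = ⊥-elim (apart 1F 2F 3F (λ ()) (λ ()) (λ ()) d e)
    labels _ _ _ (inj₁ d) _ (inj₁ f) = ⊥-elim (apart 2F 1F 3F (λ ()) (λ ()) (λ ()) (flip d) f)
    labels _ _ _ _ (inj₁ e) (inj₁ f) = ⊥-elim (apart 3F 1F 2F (λ ()) (λ ()) (λ ()) (flip e) (flip f))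

  twos-equal-or-disjoint : ∀ i j k l → i ≢ j → k ≢ l → s i j ≡ 2 → s k l ≡ 2 →
    (i ≡ k × j ≡ l ⊎ i ≡ l × j ≡ k) ⊎ (i ≢ k × i ≢ l × j ≢ k × j ≢ l)
  twos-equal-or-disjoint i j k l i≢j k≢l ij kl with i ≟ k | i ≟ l | j ≟ k | j ≟ l
  ... | yes refl | _        | _        | yes refl = inj₁ (inj₁ (refl , refl))
  ... | yes refl | _        | _        | no  j≢l  = ⊥-elim (apart i j l i≢j k≢l j≢l ij kl)
  ... | no  _    | yes refl | yes refl | _        = inj₁ (inj₂ (refl , refl))
  ... | no  i≢k  | yes refl | no  j≢k  | _        = ⊥-elim (apart i j k i≢j i≢k j≢k ij (trans (s-sym i k) kl))
  ... | no  i≢k  | no  i≢l  | yes refl | _        = ⊥-elim (apart j i l (i≢j ∘ sym) k≢l i≢l (trans (s-sym j i) ij) kl)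
  ... | no  i≢k  | no  i≢l  | no  j≢k  | yes refl = ⊥-elim (apart j i k (i≢j ∘ sym) (k≢l ∘ sym) i≢k (trans (s-sym j i) ij) (trans (s-sym j k) kl))
  ... | no  i≢k  | no  i≢l  | no  j≢k  | no  j≢l  = inj₂ (i≢k , i≢l , j≢k , j≢l)

-- 12-caps of dimension 7

∣p∣≡8⇒∣⊤─p∣≡4 : ∀ (p : Subset 12) → ∣ p ∣ ≡ 8 → ∣ ⊤ ─ p ∣ ≡ 4
∣p∣≡8⇒∣⊤─p∣≡4 p ∣p∣≡8 = +-cancelʳ-≡ 8 ∣ ⊤ ─ p ∣ 4 (trans (cong (∣ ⊤ ─ p ∣ +_) (sym ∣p∣≡8)) (∣⊤─p∣+∣p∣≡n p))

∣⊤─p∣≡4⇒∣p∣≡8 : ∀ (p : Subset 12) → ∣ ⊤ ─ p ∣ ≡ 4 → ∣ p ∣ ≡ 8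
∣⊤─p∣≡4⇒∣p∣≡8 p ∣⊤─p∣≡4 = +-cancelˡ-≡ 4 ∣ p ∣ 8 (trans (cong (_+ ∣ p ∣) (sym ∣⊤─p∣≡4)) (∣⊤─p∣+∣p∣≡n p))

module _ {n} {C : Fin 12 → V n} (C-injective : Injective _≡_ _≡_ C) (cap : IsCap C ⊤) where

  type-5555 : ∀ {B} (basis : Basis C B) → ∣ B ∣ ≡ 8 → (∀ x → x ∉ B → ∣ Basis.rep basis x ∣ ≡ 5) → Type5555 C ⊤ B
  type-5555 {B} basis ∣B∣≡8 sizes =
    ∣p∣≡8⇒∣⊤─p∣≡4 B ∣B∣≡8 ,
    λ x x∈ → rep x , rep-isBx x , sizes x (x∈p─q⇒x∉q ⊤ B x∈)
    where open Basis basis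

  module WithSeven {B} (basis : Basis C B) (∣B∣≡8 : ∣ B ∣ ≡ 8)
                   {y₇} (y₇∉B : y₇ ∉ B) (∣y₇∣≡7 : ∣ Basis.rep basis y₇ ∣ ≡ 7) where

    open Basis basis
    open Dependents C-injective cap basis
    open EightPointBasis ∣B∣≡8

    ∣rep∣≡5 : ∀ {j} → j ∉ B → j ≢ y₇ → ∣ rep j ∣ ≡ 5
    ∣rep∣≡5 j∉B j≢y₇ = [ id , (λ ≡7 → ⊥-elim (¬7-7 j∉B y₇∉B j≢y₇ ≡7 ∣y₇∣≡7)) ]′ (∣rep∣≡5⊎7 j∉B)

    another-dependent : ∃ λ y → y ∉ B × y ≢ y₇
    another-dependent = let (y , y∈) = ∣p∣≡suc⇒nonempty ((⊤ ─ B) ⊕ ⁅ y₇ ⁆) ∣D-y₇∣≡3 in y , dependent y∈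
      where
      y₇∈D : y₇ ∈ ⊤ ─ B
      y₇∈D = x∈p∧x∉q⇒x∈p─q ∈⊤ y₇∉B
      ∣D-y₇∣≡3 : ∣ (⊤ ─ B) ⊕ ⁅ y₇ ⁆ ∣ ≡ 3
      ∣D-y₇∣≡3 = suc-injective (trans (∣p⊕⁅x⁆∣-∈ y₇∈D) (∣p∣≡8⇒∣⊤─p∣≡4 B ∣B∣≡8))
      dependent : ∀ {y} → y ∈ (⊤ ─ B) ⊕ ⁅ y₇ ⁆ → y ∉ B × y ≢ y₇
      dependent {y} y∈ with ∈⊕⁻ (⊤ ─ B) ⁅ y₇ ⁆ y∈
      ... | inj₁ (y∈D , y∉⁅y₇⁆) = x∈p─q⇒x∉q ⊤ B y∈D , λ { refl → y∉⁅y₇⁆ (x∈⁅x⁆ y₇) }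
      ... | inj₂ (y∉D , y∈⁅y₇⁆) = contradiction (subst (_∈ ⊤ ─ B) (sym (x∈⁅y⁆⇒x≡y y₇ y∈⁅y₇⁆)) y₇∈D) y∉D

    y₁ : Fin 12
    y₁ = proj₁ another-dependent

    y₁∉B : y₁ ∉ B
    y₁∉B = proj₁ (proj₂ another-dependent)

    y₁≢y₇ : y₁ ≢ y₇
    y₁≢y₇ = proj₂ (proj₂ another-dependent)

    ∣y₁∣≡5 : ∣ rep y₁ ∣ ≡ 5
    ∣y₁∣≡5 = ∣rep∣≡5 y₁∉B y₁≢y₇

    ∣y₁∩y₇∣≡4 : ∣ rep y₁ ∩ rep y₇ ∣ ≡ 4
    ∣y₁∩y₇∣≡4 = ∣rep∩rep∣≡4 y₁∉B y₇∉B y₁≢y₇ ∣y₁∣≡5 ∣y₇∣≡7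

    b : Fin 12
    b = proj₁ (∣p∣≡suc⇒nonempty (rep y₁ ∩ rep y₇) ∣y₁∩y₇∣≡4)

    b∈y₁∩y₇ : b ∈ rep y₁ × b ∈ rep y₇
    b∈y₁∩y₇ = x∈p∩q⁻ (rep y₁) (rep y₇) (proj₂ (∣p∣≡suc⇒nonempty (rep y₁ ∩ rep y₇) ∣y₁∩y₇∣≡4))

    open Exchange basis y₁∉B (proj₁ b∈y₁∩y₇)

    ∣y₁⊕rep∣≡4 : ∀ {j} → j ∉ B → j ≢ y₁ → Dec (j ≡ y₇) → ∣ rep y₁ ⊕ rep j ∣ ≡ 4
    ∣y₁⊕rep∣≡4 _ _ (yes refl) = ∣⊕∣≡ (rep y₁) (rep y₇) ∣y₁∣≡5 ∣y₇∣≡7 ∣y₁∩y₇∣≡4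
    ∣y₁⊕rep∣≡4 {j} j∉B j≢y₁ (no j≢y₇) = from-∩ (∣rep∩rep∣≡2⊎3 y₁∉B j∉B (j≢y₁ ∘ sym) ∣y₁∣≡5 ∣j∣≡5)
      where
      ∣j∣≡5 : ∣ rep j ∣ ≡ 5
      ∣j∣≡5 = ∣rep∣≡5 j∉B j≢y₇
      from-∩ : ∣ rep y₁ ∩ rep j ∣ ≡ 2 ⊎ ∣ rep y₁ ∩ rep j ∣ ≡ 3 → ∣ rep y₁ ⊕ rep j ∣ ≡ 4
      from-∩ (inj₂ ≡3) = ∣⊕∣≡ (rep y₁) (rep j) ∣y₁∣≡5 ∣j∣≡5 ≡3
      from-∩ (inj₁ ≡2) = ⊥-elim (¬5-5-7-with-2-4-4 y₁∉B j∉B y₇∉B (j≢y₁ ∘ sym) y₁≢y₇ j≢y₇ ∣y₁∣≡5 ∣j∣≡5 ∣y₇∣≡7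
                           ≡2 ∣y₁∩y₇∣≡4 (∣rep∩rep∣≡4 j∉B y₇∉B j≢y₇ ∣j∣≡5 ∣y₇∣≡7))

    rep-b : rep b ≡ ⁅ b ⁆
    rep-b = sym (isBx⇒≡rep (x∈p⇒⁅x⁆⊆p b∈B , odd-∣⁅⁆∣ b , sumOver-⁅⁆ C b))

    ∣rep′∣≡5 : ∀ j → j ∉ B′ → ∣ rep′ j ∣ ≡ 5
    ∣rep′∣≡5 j j∉B′ = by-cases (dependent′ j∉B′)
      where
      changed : b ∈ rep j → ∣ rep y₁ ⊕ rep j ∣ ≡ 4 → ∣ rep′ j ∣ ≡ 5
      changed b∈j ∣y₁⊕j∣≡4 = trans (cong ∣_∣ (rep′-∈ b∈j)) (trans (∣K⊕X∣ (rep⊆B j)) (cong suc ∣y₁⊕j∣≡4))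
      by-cases : j ≡ b ⊎ j ∉ B × j ≢ y₁ → ∣ rep′ j ∣ ≡ 5
      by-cases (inj₁ refl) = changed (subst (b ∈_) (sym rep-b) (x∈⁅x⁆ b))
        (suc-injective (trans (cong (suc ∘ ∣_∣ ∘ (rep y₁ ⊕_)) rep-b) (trans (∣p⊕⁅x⁆∣-∈ (proj₁ b∈y₁∩y₇)) ∣y₁∣≡5)))
      by-cases (inj₂ (j∉B , j≢y₁)) = by-membership (b ∈? rep j)
        where
        by-membership : Dec (b ∈ rep j) → ∣ rep′ j ∣ ≡ 5
        by-membership (yes b∈j) = changed b∈j (∣y₁⊕rep∣≡4 j∉B j≢y₁ (j ≟ y₇))
        by-membership (no  b∉j) = trans (cong ∣_∣ (rep′-∉ b∉j)) (∣rep∣≡5 j∉B λ { refl → b∉j (proj₂ b∈y₁∩y₇) })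

    exchanged-basis : ∃ λ B → IsBasis C ⊤ B × Type5555 C ⊤ B
    exchanged-basis = B′ , Basis.isBasis basis′ , type-5555 basis′ (trans ∣B′∣≡∣B∣ ∣B∣≡8) ∣rep′∣≡5

  basis-of-type-5555 : HasDim C ⊤ 7 → ∃ λ B → IsBasis C ⊤ B × Type5555 C ⊤ B
  basis-of-type-5555 dim = improve (basis-of-dimension 7 C dim)
    where
    improve : (∃ λ B → ∣ B ∣ ≡ 8 × Basis C B) → ∃ λ B → IsBasis C ⊤ B × Type5555 C ⊤ B
    improve (B , ∣B∣≡8 , basis) = seven? (any? λ y → (y ∈? ⊤ ─ B) ×-dec (∣ rep y ∣ ℕ.≟ 7))
      where
      open Basis basis
      open Dependents C-injective cap basis
      open EightPointBasis ∣B∣≡8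
      seven? : Dec (∃ λ y → y ∈ ⊤ ─ B × ∣ rep y ∣ ≡ 7) → ∃ λ B → IsBasis C ⊤ B × Type5555 C ⊤ B
      seven? (yes (y₇ , y₇∈D , ∣y₇∣≡7)) = WithSeven.exchanged-basis basis ∣B∣≡8 (x∈p─q⇒x∉q ⊤ B y₇∈D) ∣y₇∣≡7
      seven? (no  no-7) = B , isBasis , type-5555 basis ∣B∣≡8 λ x x∉B →
        [ id , (λ ≡7 → ⊥-elim (no-7 (x , x∈p∧x∉q⇒x∈p─q ∈⊤ x∉B , ≡7))) ]′ (∣rep∣≡5⊎7 x∉B)

  module FourDependents {B} (is-basis : IsBasis C ⊤ B) (B-type : Type5555 C ⊤ B)
    (x : Fin 4 → Fin 12) (x-injective : Injective _≡_ _≡_ x) (x∈D : ∀ i → x i ∈ ⊤ ─ B)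
    (Bx : Fin 4 → Subset 12) (Bx-isBx : ∀ i → IsBx C B (x i) (Bx i)) where

    basis : Basis C B
    basis = IsBasis⇒Basis is-basis

    open Basis basis
    open Dependents C-injective cap basis
    open EightPointBasis (∣⊤─p∣≡4⇒∣p∣≡8 B (proj₁ B-type))

    x∉B : ∀ i → x i ∉ B
    x∉B i = x∈p─q⇒x∉q ⊤ B (x∈D i)

    x-distinct : ∀ {i j} → i ≢ j → x i ≢ x j
    x-distinct i≢j xi≡xj = i≢j (x-injective xi≡xj)

    ∣rep∣≡5 : ∀ i → ∣ rep (x i) ∣ ≡ 5
    ∣rep∣≡5 i = let (T , T-isBx , ∣T∣≡5) = proj₂ B-type (x i) (x∈D i) in trans (cong ∣_∣ (sym (isBx⇒≡rep T-isBx))) ∣T∣≡5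

    s : Fin 4 → Fin 4 → ℕ
    s i j = ∣ Bx i ∩ Bx j ∣

    s≡ : ∀ i j → s i j ≡ ∣ rep (x i) ∩ rep (x j) ∣
    s≡ i j = cong₂ (λ X Y → ∣ X ∩ Y ∣) (isBx⇒≡rep (Bx-isBx i)) (isBx⇒≡rep (Bx-isBx j))

    s-sym : ∀ i j → s i j ≡ s j i
    s-sym i j = cong ∣_∣ (∩-comm (Bx i) (Bx j))

    s≡2⊎3 : ∀ i j → i ≢ j → s i j ≡ 2 ⊎ s i j ≡ 3
    s≡2⊎3 i j i≢j = subst (λ v → v ≡ 2 ⊎ v ≡ 3) (sym (s≡ i j))
      (∣rep∩rep∣≡2⊎3 (x∉B i) (x∉B j) (x-distinct i≢j) (∣rep∣≡5 i) (∣rep∣≡5 j))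

    apart : ∀ i j k → i ≢ j → i ≢ k → j ≢ k → s i j ≡ 2 → s i k ≢ 2
    apart i j k i≢j i≢k j≢k ij ik = ¬5-5-5-with-2-2 (x∉B i) (x∉B j) (x∉B k)
      (x-distinct i≢j) (x-distinct i≢k) (x-distinct j≢k) (∣rep∣≡5 i) (∣rep∣≡5 j) (∣rep∣≡5 k)
      (trans (sym (s≡ i j)) ij) (trans (sym (s≡ i k)) ik)

    not-all-3 : ¬ (s 0F 1F ≡ 3 × s 0F 2F ≡ 3 × s 0F 3F ≡ 3 × s 1F 2F ≡ 3 × s 1F 3F ≡ 3 × s 2F 3F ≡ 3)
    not-all-3 (e₀₁ , e₀₂ , e₀₃ , e₁₂ , e₁₃ , e₂₃) = ¬5-5-5-5-with-3s (x∉B _) (x∉B _) (x∉B _) (x∉B _)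
      (x-distinct (λ ())) (x-distinct (λ ())) (x-distinct (λ ())) (x-distinct (λ ())) (x-distinct (λ ())) (x-distinct (λ ()))
      (∣rep∣≡5 _) (∣rep∣≡5 _) (∣rep∣≡5 _) (∣rep∣≡5 _)
      (trans (sym (s≡ _ _)) e₀₁) (trans (sym (s≡ _ _)) e₀₂) (trans (sym (s≡ _ _)) e₀₃)
      (trans (sym (s≡ _ _)) e₁₂) (trans (sym (s≡ _ _)) e₁₃) (trans (sym (s≡ _ _)) e₂₃)

proposition7p3 :
    (n : ℕ) (C : Fin 12 → V n) → Injective _≡_ _≡_ C →
    IsCap C ⊤ → HasDim C ⊤ 7 →
    (∃ λ B → IsBasis C ⊤ B × Type5555 C ⊤ B)
    × (∀ B → IsBasis C ⊤ B → Type5555 C ⊤ B →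
       ∀ (x : Fin 4 → Fin 12) → Injective _≡_ _≡_ x → (∀ i → x i ∈ ⊤ ─ B) →
       ∀ (Bx : Fin 4 → Subset 12) → (∀ i → IsBx C B (x i) (Bx i)) →
       ((count2 (λ i j → ∣ Bx i ∩ Bx j ∣) ≡ 1 ⊎ count2 (λ i j → ∣ Bx i ∩ Bx j ∣) ≡ 2)
        × (∀ i j → i ≢ j → ∣ Bx i ∩ Bx j ∣ ≡ 2 ⊎ ∣ Bx i ∩ Bx j ∣ ≡ 3))
       × (∀ i j k l → i ≢ j → k ≢ l →
          ∣ Bx i ∩ Bx j ∣ ≡ 2 → ∣ Bx k ∩ Bx l ∣ ≡ 2 →
          ((i ≡ k × j ≡ l) ⊎ (i ≡ l × j ≡ k))
          ⊎ (i ≢ k × i ≢ l × j ≢ k × j ≢ l)))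
proposition7p3 n C C-injective cap dim =
  basis-of-type-5555 C-injective cap dim ,
  λ B is-basis B-type x x-injective x∈D Bx Bx-isBx →
    let open FourDependents C-injective cap is-basis B-type x x-injective x∈D Bx Bx-isBx in
    (count2-matching s s-sym apart s≡2⊎3 not-all-3 , s≡2⊎3) , twos-equal-or-disjoint s s-sym apart
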